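{- Let $f=\gamma_0+\sum_{i=1}^{t}a_i\gamma_{2i}$ with $a_i\in\mathbb{F}_2$, viewed as a shift-invariant function on $\mathbb{F}_2^n$ for every $n\geq1$. Let $F(X)=1+\sum_{i=1}^ta_iX^i\in\mathbb{F}_2[X]$ and let $F=g_1^{e_1}\cdots g_r^{e_r}$ ($e_j\geq1$) be its factorization into distinct irreducible polynomials. Then $\xi(f)=\{2\,\mathrm{ord}(g_j): j=1,\dots,r\}$; that is, for every $n\geq1$, $f$ fails to be a permutation of $\mathbb{F}_2^n$ if and only if $n$ is a multiple of $2\,\mathrm{ord}(g_j)$ for some $j$. In particular $\xi(f)$ is finite and $\mathrm{inv}(f)$ is infinite.
   Context: For $n\geq1$ let $\mathbbm{1}=(1,\dots,1)\in\mathbb{F}_2^n$, let $\odot$ denote component-wise multiplication in $\mathbb{F}_2^n$, and let $S(x_1,\dots,x_n)=(x_2,\dots,x_n,x_1)$. Define $\gamma_0=\mathrm{id}$ and, for $k\geq1$, $\gamma_{2k}(x)=S^{2k}(x)\odot(\mathbbm{1}+S^{2k-1}(x))\odot(\mathbbm{1}+S^{2k-3}(x))\odot\cdots\odot(\mathbbm{1}+S(x))$ on $\mathbb{F}_2^n$ (indices of $S$ taken mod $n$); sums are pointwise. For such a function $f$, $\mathrm{inv}(f)=\{n\in\mathbb{N}: f \text{ is a permutation of } \mathbb{F}_2^n\}$, and $\xi(f)$ denotes a set of positive integers generating the complement, i.e. $n\notin\mathrm{inv}(f)$ iff $n$ is a multiple of some element of $\xi(f)$. For $g\in\mathbb{F}_2[X]$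 with $g(0)=1$, $\mathrm{ord}(g)$ is the least $\ell\geq1$ with $g\mid X^\ell+1$. -}

module Defs where

open import Data.Bool using (Bool; true; false; _∧_; _xor_; not)
open import Data.Nat using (ℕ; zero; suc; _+_; _*_; _<_; _≤_; _%_)
open import Data.Nat.Divisibility using (_∣_)
open import Data.Fin using (Fin; toℕ; fromℕ<)
open import Data.Fin.Properties using ()
open import Data.Nat.DivMod using (m%n<n)
open import Data.Vec using (Vec; []; _∷_; lookup; tabulate; toList)
open import Data.List using (List; []; _∷_; length; replicate; _++_; map)
open import Data.List using (List)
open import Data.Product using (Σ; _×_; ∃; ∃-syntax)
open import Data.Sum using (_⊎_)
open import Relation.Binary.PropositionalEquality using (_≡_)
open import Relation.Nullary using (¬_)
open import Function.Definitions using (Bijective)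

-- Vectors in F₂^n (n = suc m ≥ 1), with F₂ = Bool (xor = +, ∧ = ·).

shiftIdx : ∀ {m} → ℕ → Fin (suc m) → Fin (suc m)
shiftIdx {m} k i = fromℕ< (m%n<n (toℕ i + k) (suc m))

S^ : ∀ {m} → ℕ → Vec Bool (suc m) → Vec Bool (suc m)
S^ k x = tabulate (λ i → lookup x (shiftIdx k i))

-- ∧ over odd j = 2k-1, 2k-3, …, 1 of (1 + (S^j x)_i), i.e. ¬ x_{i+j}
oddNegs : ∀ {m} → ℕ → Vec Bool (suc m) → Fin (suc m) → Bool
oddNegs zero    x i = true
oddNegs (suc k) x i = not (lookup x (shiftIdx (k + suc k) i)) ∧ oddNegs k x i

-- γ_{2k}(x) = S^{2k}(x) ⊙ (1 + S^{2k-1}(x)) ⊙ … ⊙ (1 + S(x))   (k ≥ 1)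
γ₂ : ∀ {m} → ℕ → Vec Bool (suc m) → Vec Bool (suc m)
γ₂ k x = tabulate (λ i → lookup (S^ (k + k) x) i ∧ oddNegs k x i)

sumFrom : ∀ {m t} → ℕ → Vec Bool t → Vec Bool (suc m) → Fin (suc m) → Bool
sumFrom k []       x j = false
sumFrom k (a ∷ as) x j = (a ∧ lookup (γ₂ k x) j) xor sumFrom (suc k) as x j

fMap : ∀ {t} → Vec Bool t → (m : ℕ) → Vec Bool (suc m) → Vec Bool (suc m)
fMap a m x = tabulate (λ j → lookup x j xor sumFrom 1 a x j)

IsPerm : ∀ {t} → Vec Bool t → ℕ → Set
IsPerm a m = Bijective _≡_ _≡_ (fMap a m)

-- Polynomials over F₂ as coefficient lists, lowest degree first.
-- Two lists denote the same polynomial iff their normal forms agree.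

Poly : Set
Poly = List Bool

consN : Bool → Poly → Poly
consN false [] = []
consN b     p  = b ∷ p

norm : Poly → Poly
norm []       = []
norm (b ∷ bs) = consN b (norm bs)

_+ₚ_ : Poly → Poly → Poly
[]       +ₚ q        = q
(a ∷ p)  +ₚ []       = a ∷ p
(a ∷ p)  +ₚ (b ∷ q)  = (a xor b) ∷ (p +ₚ q)

scale : Bool → Poly → Poly
scale b p = map (b ∧_) p

_*ₚ_ : Poly → Poly → Poly
[]      *ₚ q = []
(a ∷ p) *ₚ q = scale a q +ₚ (false ∷ (p *ₚ q))

_≈ₚ_ : Poly → Poly → Set
p ≈ₚ q = norm p ≡ norm q

oneₚ : Poly
oneₚ = true ∷ []

_∣ₚ_ : Poly → Poly → Set
g ∣ₚ h = ∃[ q ] ((q *ₚ g) ≈ₚ h)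

-- irreducible: non-constant (degree ≥ 1) and every factorisation has a unit
-- factor (the only unit of F₂[X] is 1)
Irreducible : Poly → Set
Irreducible g = (1 < length (norm g))
  × (∀ p q → (p *ₚ q) ≈ₚ g → p ≈ₚ oneₚ ⊎ q ≈ₚ oneₚ)

xPow+1 : ℕ → Poly
xPow+1 ℓ = (replicate ℓ false ++ (true ∷ [])) +ₚ oneₚ

IsOrd : Poly → ℕ → Set
IsOrd g ℓ = (1 ≤ ℓ) × (g ∣ₚ xPow+1 ℓ) × (∀ k → 1 ≤ k → k < ℓ → ¬ (g ∣ₚ xPow+1 k))

Fpoly : ∀ {t} → Vec Bool t → Poly
Fpoly a = true ∷ toList a

{-# OPTIONS --safe #-}

-- For C = Σ cₖ Xᵏ put Γ_C = Σ cₖ γ₂ₖ, so that f = Γ_F. The key identity is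
-- Γ_B ∘ Γ_A = Γ_(BA) whenever A(0) = 1. On n-periodic sequences some M acts as zero:
-- X^(r+1) for n = 2r + 1, and X^h (X^h + 1) for n = 2h. If gcd(F, M) = 1, Bézout gives
-- U F ≡ 1 (mod M) and Γ_U inverts f; this always happens for odd n, and otherwise an
-- irreducible common factor g of F and X^h + 1 has ord(g) ∣ h, i.e. 2 ord(g) ∣ n.
-- Conversely, if g ∣ F, Q g = X^ℓ + 1 and 2ℓ ∣ n, let δ be the indicator of the
-- multiples of 2ℓ: Γ_(X^ℓ+1) kills δ, so f sends both Γ_Q δ ≠ 0 and 0 to 0.
module Submission where

open import Defs
open import Algebra.Bundles using (CommutativeMonoid; CommutativeRing)
import Algebra.Properties.CommutativeSemigroup as CommutativeSemigroupProperties
open import Data.Bool using (Bool; true; false; _∧_; _xor_; not)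
open import Data.Bool.Properties
  using ( ∧-assoc; ∧-comm; ∧-identityʳ; ∧-zeroʳ; ∧-conicalˡ; ∧-conicalʳ; ∧-distribˡ-xor; ∧-distribʳ-xor
        ; xor-comm; xor-assoc; xor-identityʳ; xor-same; ∧-commutativeMonoid; xor-∧-commutativeRing )
open import Data.Fin using (Fin; toℕ; fromℕ<)
import Data.Fin as Fin
open import Data.Fin.Properties using (toℕ-fromℕ<; toℕ-injective; toℕ<n; fromℕ<-cong)
open import Data.Fin.Subset.Properties using (anySubset?)
open import Data.List using ([]; _∷_; replicate; _++_; length)
open import Data.Nat using (ℕ; zero; suc; _+_; _*_; _≤_; _<_; z≤n; s≤s; _≤?_)
open import Data.Nat.DivMod using (_%_; _/_; m%n<n; m≡m%n+[m/n]*n; m<n⇒m%n≡m; %-remove-+ˡ; [m+kn]%n≡m%n)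
open import Data.Nat.Divisibility
  using (_∣_; _∣?_; m%n≡0⇒n∣m; n∣m⇒m%n≡0; ∣-refl; ∣-trans; *-monoʳ-∣; ∣m+n∣m⇒∣n; ∣m∣n⇒∣m+n; m∣m*n; ∣⇒≤)
import Data.Nat.Divisibility as ℕ
open import Data.Nat.Induction using (<-rec)
open import Data.Nat.Properties
  using ( ≤-refl; ≤-trans; ≤-antisym; ≤-pred; <⇒≤; <⇒≱; ≤⇒≯; ≰⇒>; m≤n+m; m≤m+n; m<m+n; m<n⇒m<1+n
        ; m≤n⇒m<n∨m≡n; 0≢1+n; suc-injective; +-identityʳ; +-suc; +-assoc; +-comm; *-comm; +-mono-<
        ; +-commutativeSemigroup )
open import Data.Product using (_,_; _×_; ∃; ∃-syntax; proj₁; proj₂)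
open import Data.Sum using (_⊎_; inj₁; inj₂; [_,_]′)
open import Data.Vec using (Vec; toList; lookup; tabulate)
import Data.Vec as Vec
open import Data.Vec.Properties using (length-toList; lookup∘tabulate; tabulate∘lookup; tabulate-cong)
open import Function using (_∘_; case_of_; id; flip)
open import Function.Bundles using (_⇔_; mk⇔)
open import Relation.Binary.Bundles using (Setoid)
open import Relation.Binary.PropositionalEquality
  using (_≡_; _≢_; _≗_; refl; sym; trans; cong; cong₂; subst; module ≡-Reasoning)
import Relation.Binary.Reasoning.Setoid as SetoidReasoning
open import Relation.Nullary using (¬_; Dec; yes; no; contradiction; map′; _×-dec_)
open import Relation.Nullary.Decidable using (does; dec-true; dec-false)
open import Relation.Unary using (Decidable)

open CommutativeSemigroupProperties +-commutativeSemigroup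
  using () renaming (interchange to ℕ-interchange; x∙yz≈y∙xz to ℕ-swap)
open CommutativeSemigroupProperties (CommutativeRing.+-commutativeSemigroup xor-∧-commutativeRing)
  using () renaming (interchange to xor-interchange)
open CommutativeSemigroupProperties (CommutativeMonoid.commutativeSemigroup ∧-commutativeMonoid)
  using () renaming (x∙yz≈y∙xz to ∧-swap)

-- Polynomial arithmetic over F₂

coeff : Poly → ℕ → Bool
coeff []      _       = false
coeff (b ∷ p) zero    = b
coeff (b ∷ p) (suc i) = coeff p i

coeff-consN : ∀ b p i → coeff (consN b p) i ≡ coeff (b ∷ p) i
coeff-consN false []      zero    = refl
coeff-consN false []      (suc i) = refl
coeff-consN false (_ ∷ _) i       = refl
coeff-consN true  p       i       = refl

coeff-norm : ∀ p i → coeff (norm p) i ≡ coeff p i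
coeff-norm []      i       = refl
coeff-norm (b ∷ p) zero    = coeff-consN b (norm p) zero
coeff-norm (b ∷ p) (suc i) = trans (coeff-consN b (norm p) (suc i)) (coeff-norm p i)

-- Equality of coefficients. Unlike ≈ₚ it is a record, so its indices can be inferred.
infix 4 _≐_
record _≐_ (p q : Poly) : Set where
  constructor coeffwise
  field coeff-≡ : ∀ i → coeff p i ≡ coeff q i
open _≐_

≐-refl : ∀ {p} → p ≐ p
≐-refl = coeffwise λ _ → refl

≐-sym : ∀ {p q} → p ≐ q → q ≐ p
≐-sym e = coeffwise (sym ∘ coeff-≡ e)

≐-trans : ∀ {p q r} → p ≐ q → q ≐ r → p ≐ r
≐-trans e f = coeffwise λ i → trans (coeff-≡ e i) (coeff-≡ f i)

≐-setoid : Setoid _ _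
≐-setoid = record
  { Carrier       = Poly
  ; _≈_           = _≐_
  ; isEquivalence = record { refl = ≐-refl ; sym = ≐-sym ; trans = ≐-trans }
  }

module ≐-Reasoning = SetoidReasoning ≐-setoid

≈ₚ⇒≐ : ∀ {p q} → p ≈ₚ q → p ≐ q
≈ₚ⇒≐ {p} {q} p≈q = coeffwise λ i →
  trans (sym (coeff-norm p i)) (trans (cong (λ r → coeff r i) p≈q) (coeff-norm q i))

≐[]⇒≈ₚ : ∀ {p} → p ≐ [] → p ≈ₚ []
≐[]⇒≈ₚ {[]}    e = refl
≐[]⇒≈ₚ {a ∷ p} e = cong₂ consN (coeff-≡ e 0) (≐[]⇒≈ₚ {p} (coeffwise (coeff-≡ e ∘ suc)))

≐⇒≈ₚ : ∀ {p q} → p ≐ q → p ≈ₚ q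
≐⇒≈ₚ {[]}    {q}     e = sym (≐[]⇒≈ₚ (≐-sym e))
≐⇒≈ₚ {a ∷ p} {[]}    e = ≐[]⇒≈ₚ e
≐⇒≈ₚ {a ∷ p} {b ∷ q} e = cong₂ consN (coeff-≡ e 0) (≐⇒≈ₚ {p} {q} (coeffwise (coeff-≡ e ∘ suc)))

∷-cong : ∀ {a b p q} → a ≡ b → p ≐ q → (a ∷ p) ≐ (b ∷ q)
∷-cong a≡b e = coeffwise λ { zero → a≡b ; (suc i) → coeff-≡ e i }

∷-injectiveʳ : ∀ {a b p q} → (a ∷ p) ≐ (b ∷ q) → p ≐ q
∷-injectiveʳ e = coeffwise (coeff-≡ e ∘ suc)

coeff-+ : ∀ p q i → coeff (p +ₚ q) i ≡ coeff p i xor coeff q i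
coeff-+ []      q       i       = refl
coeff-+ (a ∷ p) []      i       = sym (xor-identityʳ _)
coeff-+ (a ∷ p) (b ∷ q) zero    = refl
coeff-+ (a ∷ p) (b ∷ q) (suc i) = coeff-+ p q i

+ₚ-cong : ∀ {p p' q q'} → p ≐ p' → q ≐ q' → (p +ₚ q) ≐ (p' +ₚ q')
+ₚ-cong {p} {p'} {q} {q'} e f = coeffwise λ i →
  trans (coeff-+ p q i) (trans (cong₂ _xor_ (coeff-≡ e i) (coeff-≡ f i)) (sym (coeff-+ p' q' i)))

+ₚ-congˡ : ∀ p {q q'} → q ≐ q' → (p +ₚ q) ≐ (p +ₚ q')
+ₚ-congˡ p = +ₚ-cong (≐-refl {p})

+ₚ-comm : ∀ p q → (p +ₚ q) ≐ (q +ₚ p)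
+ₚ-comm p q = coeffwise λ i →
  trans (coeff-+ p q i) (trans (xor-comm (coeff p i) _) (sym (coeff-+ q p i)))

+ₚ-assoc : ∀ p q r → ((p +ₚ q) +ₚ r) ≐ (p +ₚ (q +ₚ r))
+ₚ-assoc p q r = coeffwise λ i → begin
  coeff ((p +ₚ q) +ₚ r) i                   ≡⟨ trans (coeff-+ (p +ₚ q) r i) (cong (_xor coeff r i) (coeff-+ p q i)) ⟩
  (coeff p i xor coeff q i) xor coeff r i   ≡⟨ xor-assoc (coeff p i) _ _ ⟩
  coeff p i xor (coeff q i xor coeff r i)   ≡⟨ sym (trans (coeff-+ p (q +ₚ r) i) (cong (coeff p i xor_) (coeff-+ q r i))) ⟩
  coeff (p +ₚ (q +ₚ r)) i                   ∎
  where open ≡-Reasoning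

+ₚ-identityʳ : ∀ p → (p +ₚ []) ≐ p
+ₚ-identityʳ []      = ≐-refl
+ₚ-identityʳ (_ ∷ _) = ≐-refl

+ₚ-self : ∀ p → (p +ₚ p) ≐ []
+ₚ-self p = coeffwise λ i → trans (coeff-+ p p i) (xor-same (coeff p i))

+ₚ-identityˡ : ∀ p → ([] +ₚ p) ≐ p
+ₚ-identityˡ p = ≐-refl

+ₚ-commutativeMonoid : CommutativeMonoid _ _
+ₚ-commutativeMonoid = record
  { Carrier             = Poly
  ; _≈_                 = _≐_
  ; _∙_                 = _+ₚ_
  ; ε                   = []
  ; isCommutativeMonoid = record
    { isMonoid = record
      { isSemigroup = record
        { isMagma = record
          { isEquivalence = Setoid.isEquivalence ≐-setoid
          ; ∙-cong        = +ₚ-cong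
          }
        ; assoc = +ₚ-assoc
        }
      ; identity = +ₚ-identityˡ , +ₚ-identityʳ
      }
    ; comm = +ₚ-comm
    }
  }

open CommutativeSemigroupProperties (CommutativeMonoid.commutativeSemigroup +ₚ-commutativeMonoid)
  using () renaming (interchange to +ₚ-interchange; x∙yz≈y∙xz to +ₚ-swap)

+ₚ-cancelˡ : ∀ p q → (p +ₚ (p +ₚ q)) ≐ q
+ₚ-cancelˡ p q = begin
  p +ₚ (p +ₚ q)   ≈⟨ ≐-sym (+ₚ-assoc p p q) ⟩
  (p +ₚ p) +ₚ q   ≈⟨ +ₚ-cong (+ₚ-self p) ≐-refl ⟩
  q               ∎
  where open ≐-Reasoning

+ₚ-solve : ∀ {p q r} → p ≐ q +ₚ r → r ≐ p +ₚ q
+ₚ-solve {p} {q} {r} e = ≐-trans (≐-sym (+ₚ-cancelˡ q r)) (≐-trans (+ₚ-congˡ q (≐-sym e)) (+ₚ-comm q p))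

coeff-scale : ∀ b p i → coeff (scale b p) i ≡ b ∧ coeff p i
coeff-scale b []      i       = sym (∧-zeroʳ b)
coeff-scale b (a ∷ p) zero    = refl
coeff-scale b (a ∷ p) (suc i) = coeff-scale b p i

scale-cong : ∀ b {p q} → p ≐ q → scale b p ≐ scale b q
scale-cong b {p} {q} e = coeffwise λ i →
  trans (coeff-scale b p i) (trans (cong (b ∧_) (coeff-≡ e i)) (sym (coeff-scale b q i)))

scale-true : ∀ p → scale true p ≐ p
scale-true p = coeffwise (coeff-scale true p)

scale-false : ∀ p → scale false p ≐ []
scale-false p = coeffwise (coeff-scale false p)

scale-xor : ∀ a b p → scale (a xor b) p ≐ (scale a p +ₚ scale b p)
scale-xor a b p = coeffwise λ i → begin
  coeff (scale (a xor b) p) i                     ≡⟨ coeff-scale (a xor b) p i ⟩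
  (a xor b) ∧ coeff p i                           ≡⟨ ∧-distribʳ-xor (coeff p i) a b ⟩
  (a ∧ coeff p i) xor (b ∧ coeff p i)             ≡⟨ sym (cong₂ _xor_ (coeff-scale a p i) (coeff-scale b p i)) ⟩
  coeff (scale a p) i xor coeff (scale b p) i     ≡⟨ sym (coeff-+ (scale a p) (scale b p) i) ⟩
  coeff (scale a p +ₚ scale b p) i                ∎
  where open ≡-Reasoning

scale-+ₚ : ∀ b p q → scale b (p +ₚ q) ≐ (scale b p +ₚ scale b q)
scale-+ₚ b p q = coeffwise λ i → begin
  coeff (scale b (p +ₚ q)) i                      ≡⟨ trans (coeff-scale b (p +ₚ q) i) (cong (b ∧_) (coeff-+ p q i)) ⟩
  b ∧ (coeff p i xor coeff q i)                   ≡⟨ ∧-distribˡ-xor b (coeff p i) (coeff q i) ⟩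
  (b ∧ coeff p i) xor (b ∧ coeff q i)             ≡⟨ sym (cong₂ _xor_ (coeff-scale b p i) (coeff-scale b q i)) ⟩
  coeff (scale b p) i xor coeff (scale b q) i     ≡⟨ sym (coeff-+ (scale b p) (scale b q) i) ⟩
  coeff (scale b p +ₚ scale b q) i                ∎
  where open ≡-Reasoning

scale-scale : ∀ a b p → scale a (scale b p) ≐ scale (a ∧ b) p
scale-scale a b p = coeffwise λ i → begin
  coeff (scale a (scale b p)) i   ≡⟨ trans (coeff-scale a (scale b p) i) (cong (a ∧_) (coeff-scale b p i)) ⟩
  a ∧ (b ∧ coeff p i)             ≡⟨ sym (∧-assoc a b (coeff p i)) ⟩
  (a ∧ b) ∧ coeff p i             ≡⟨ sym (coeff-scale (a ∧ b) p i) ⟩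
  coeff (scale (a ∧ b) p) i       ∎
  where open ≡-Reasoning

X*ₚ : ∀ p q → ((false ∷ p) *ₚ q) ≐ (false ∷ (p *ₚ q))
X*ₚ p q = +ₚ-cong (scale-false q) ≐-refl

*ₚ-congʳ : ∀ p {q q'} → q ≐ q' → (p *ₚ q) ≐ (p *ₚ q')
*ₚ-congʳ []      e = ≐-refl
*ₚ-congʳ (a ∷ p) e = +ₚ-cong (scale-cong a e) (∷-cong refl (*ₚ-congʳ p e))

*ₚ-zeroʳ : ∀ p → (p *ₚ []) ≐ []
*ₚ-zeroʳ []      = ≐-refl
*ₚ-zeroʳ (a ∷ p) = coeffwise λ { zero → refl ; (suc i) → coeff-≡ (*ₚ-zeroʳ p) i }

*ₚ-∷ʳ : ∀ p b q → (p *ₚ (b ∷ q)) ≐ (scale b p +ₚ (false ∷ (p *ₚ q)))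
*ₚ-∷ʳ []      b q = coeffwise λ { zero → refl ; (suc i) → refl }
*ₚ-∷ʳ (a ∷ p) b q = ∷-cong (cong (_xor false) (∧-comm a b)) (begin
  scale a q +ₚ (p *ₚ (b ∷ q))                     ≈⟨ +ₚ-cong ≐-refl (*ₚ-∷ʳ p b q) ⟩
  scale a q +ₚ (scale b p +ₚ (false ∷ (p *ₚ q)))  ≈⟨ +ₚ-swap (scale a q) (scale b p) _ ⟩
  scale b p +ₚ (scale a q +ₚ (false ∷ (p *ₚ q)))  ∎)
  where open ≐-Reasoning

*ₚ-comm : ∀ p q → (p *ₚ q) ≐ (q *ₚ p)
*ₚ-comm []      q = ≐-sym (*ₚ-zeroʳ q)
*ₚ-comm (a ∷ p) q = ≐-trans (+ₚ-cong ≐-refl (∷-cong refl (*ₚ-comm p q))) (≐-sym (*ₚ-∷ʳ q a p))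

*ₚ-congˡ : ∀ {p p'} q → p ≐ p' → (p *ₚ q) ≐ (p' *ₚ q)
*ₚ-congˡ {p} {p'} q e = ≐-trans (*ₚ-comm p q) (≐-trans (*ₚ-congʳ q e) (*ₚ-comm q p'))

*ₚ-distribʳ : ∀ p p' q → ((p +ₚ p') *ₚ q) ≐ ((p *ₚ q) +ₚ (p' *ₚ q))
*ₚ-distribʳ []      p'       q = ≐-refl
*ₚ-distribʳ (a ∷ p) []       q = ≐-sym (+ₚ-identityʳ _)
*ₚ-distribʳ (a ∷ p) (b ∷ p') q = begin
  scale (a xor b) q +ₚ (false ∷ ((p +ₚ p') *ₚ q))
    ≈⟨ +ₚ-cong (scale-xor a b q) (∷-cong refl (*ₚ-distribʳ p p' q)) ⟩
  (scale a q +ₚ scale b q) +ₚ ((false ∷ (p *ₚ q)) +ₚ (false ∷ (p' *ₚ q)))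
    ≈⟨ +ₚ-interchange (scale a q) (scale b q) _ _ ⟩
  (scale a q +ₚ (false ∷ (p *ₚ q))) +ₚ (scale b q +ₚ (false ∷ (p' *ₚ q)))  ∎
  where open ≐-Reasoning

*ₚ-distribˡ : ∀ p q q' → (p *ₚ (q +ₚ q')) ≐ ((p *ₚ q) +ₚ (p *ₚ q'))
*ₚ-distribˡ p q q' = begin
  p *ₚ (q +ₚ q')             ≈⟨ *ₚ-comm p (q +ₚ q') ⟩
  (q +ₚ q') *ₚ p             ≈⟨ *ₚ-distribʳ q q' p ⟩
  (q *ₚ p) +ₚ (q' *ₚ p)      ≈⟨ +ₚ-cong (*ₚ-comm q p) (*ₚ-comm q' p) ⟩
  (p *ₚ q) +ₚ (p *ₚ q')      ∎
  where open ≐-Reasoning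

scale-*ₚ : ∀ b p q → (scale b p *ₚ q) ≐ scale b (p *ₚ q)
scale-*ₚ b []      q = ≐-refl
scale-*ₚ b (a ∷ p) q = begin
  scale (b ∧ a) q +ₚ (false ∷ (scale b p *ₚ q))    ≈⟨ +ₚ-cong (≐-sym (scale-scale b a q)) (∷-cong (sym (∧-zeroʳ b)) (scale-*ₚ b p q)) ⟩
  scale b (scale a q) +ₚ scale b (false ∷ (p *ₚ q)) ≈⟨ ≐-sym (scale-+ₚ b (scale a q) _) ⟩
  scale b (scale a q +ₚ (false ∷ (p *ₚ q)))         ∎
  where open ≐-Reasoning

*ₚ-assoc : ∀ p q r → ((p *ₚ q) *ₚ r) ≐ (p *ₚ (q *ₚ r))
*ₚ-assoc []      q r = ≐-refl
*ₚ-assoc (a ∷ p) q r = begin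
  (scale a q +ₚ (false ∷ (p *ₚ q))) *ₚ r           ≈⟨ *ₚ-distribʳ (scale a q) _ r ⟩
  (scale a q *ₚ r) +ₚ ((false ∷ (p *ₚ q)) *ₚ r)    ≈⟨ +ₚ-cong (scale-*ₚ a q r) (X*ₚ (p *ₚ q) r) ⟩
  scale a (q *ₚ r) +ₚ (false ∷ ((p *ₚ q) *ₚ r))    ≈⟨ +ₚ-cong ≐-refl (∷-cong refl (*ₚ-assoc p q r)) ⟩
  scale a (q *ₚ r) +ₚ (false ∷ (p *ₚ (q *ₚ r)))    ∎
  where open ≐-Reasoning

*ₚ-identityˡ : ∀ p → (oneₚ *ₚ p) ≐ p
*ₚ-identityˡ p = ≐-trans (+ₚ-cong (scale-true p) (coeffwise λ { zero → refl ; (suc i) → refl })) (+ₚ-identityʳ p)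

coeff0-*ₚ : ∀ p q → coeff (p *ₚ q) 0 ≡ coeff p 0 ∧ coeff q 0
coeff0-*ₚ []      q = refl
coeff0-*ₚ (a ∷ p) q = trans (coeff-+ (scale a q) _ 0) (trans (xor-identityʳ _) (coeff-scale a q 0))

infixr 7 X^_·_
X^_·_ : ℕ → Poly → Poly
X^ k · p = replicate k false ++ p

X^-+ : ∀ a b p → X^ (a + b) · p ≡ X^ a · X^ b · p
X^-+ zero    b p = refl
X^-+ (suc a) b p = cong (false ∷_) (X^-+ a b p)

X^·-+ₚ : ∀ k p q → X^ k · (p +ₚ q) ≡ (X^ k · p) +ₚ (X^ k · q)
X^·-+ₚ zero    p q = refl
X^·-+ₚ (suc k) p q = cong (false ∷_) (X^·-+ₚ k p q)

X^·-cong : ∀ k {p q} → p ≐ q → X^ k · p ≐ X^ k · q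
X^·-cong zero    e = e
X^·-cong (suc k) e = ∷-cong refl (X^·-cong k e)

X^·-[] : ∀ k → X^ k · [] ≐ []
X^·-[] zero    = ≐-refl
X^·-[] (suc k) = coeffwise λ { zero → refl ; (suc i) → coeff-≡ (X^·-[] k) i }

X^·-*ₚ : ∀ k p q → ((X^ k · p) *ₚ q) ≐ X^ k · (p *ₚ q)
X^·-*ₚ zero    p q = ≐-refl
X^·-*ₚ (suc k) p q = ≐-trans (X*ₚ (X^ k · p) q) (∷-cong refl (X^·-*ₚ k p q))

+ₚ-cancel-middle : ∀ p q r → ((p +ₚ q) +ₚ (q +ₚ r)) ≐ (p +ₚ r)
+ₚ-cancel-middle p q r = ≐-trans (+ₚ-assoc p q (q +ₚ r)) (+ₚ-cong ≐-refl (+ₚ-cancelˡ q r))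

xPow+1-+ : ∀ a b → xPow+1 (a + b) ≐ (X^ a · xPow+1 b) +ₚ xPow+1 a
xPow+1-+ a b = ≐-sym (begin
  (X^ a · ((X^ b · oneₚ) +ₚ oneₚ)) +ₚ ((X^ a · oneₚ) +ₚ oneₚ)
    ≡⟨ cong (_+ₚ _) (X^·-+ₚ a (X^ b · oneₚ) oneₚ) ⟩
  ((X^ a · X^ b · oneₚ) +ₚ (X^ a · oneₚ)) +ₚ ((X^ a · oneₚ) +ₚ oneₚ)
    ≈⟨ +ₚ-cancel-middle (X^ a · X^ b · oneₚ) _ oneₚ ⟩
  (X^ a · X^ b · oneₚ) +ₚ oneₚ
    ≡⟨ cong (_+ₚ oneₚ) (sym (X^-+ a b oneₚ)) ⟩
  xPow+1 (a + b) ∎)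
  where open ≐-Reasoning

-- Degrees and division with remainder

record DegBelow (p : Poly) (k : ℕ) : Set where
  constructor degBelow
  field vanishes : ∀ i → k ≤ i → coeff p i ≡ false
open DegBelow

record Deg (p : Poly) (d : ℕ) : Set where
  constructor degree
  field
    leading : coeff p d ≡ true
    below   : DegBelow p (suc d)
open Deg

DegBelow-length : ∀ p → DegBelow p (length p)
DegBelow-length p = degBelow (go p)
  where
  go : ∀ p i → length p ≤ i → coeff p i ≡ false
  go []      i       _         = refl
  go (b ∷ p) (suc i) (s≤s len) = go p i len

DegBelow-mono : ∀ {p k k'} → k ≤ k' → DegBelow p k → DegBelow p k'
DegBelow-mono k≤k' b = degBelow λ i k'≤i → vanishes b i (≤-trans k≤k' k'≤i)

DegBelow-resp : ∀ {p q k} → p ≐ q → DegBelow p k → DegBelow q k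
DegBelow-resp e b = degBelow λ i k≤i → trans (sym (coeff-≡ e i)) (vanishes b i k≤i)

DegBelow-zero : ∀ {p} → DegBelow p 0 → p ≐ []
DegBelow-zero b = coeffwise λ i → vanishes b i z≤n

DegBelow-tail : ∀ {b p k} → DegBelow (b ∷ p) (suc k) → DegBelow p k
DegBelow-tail bd = degBelow λ i k≤i → vanishes bd (suc i) (s≤s k≤i)

DegBelow-scale : ∀ b {p k} → DegBelow p k → DegBelow (scale b p) k
DegBelow-scale b {p} bd = degBelow λ i k≤i → trans (coeff-scale b p i) (trans (cong (b ∧_) (vanishes bd i k≤i)) (∧-zeroʳ b))

Deg-resp : ∀ {p q d} → p ≐ q → Deg p d → Deg q d
Deg-resp e (degree lead bd) = degree (trans (sym (coeff-≡ e _)) lead) (DegBelow-resp e bd)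

Deg⇒< : ∀ {p d k} → Deg p d → DegBelow p k → d < k
Deg⇒< {d = d} {k} D bd with k ≤? d
... | yes k≤d = contradiction (trans (sym (leading D)) (vanishes bd d k≤d)) λ ()
... | no  k≰d = ≰⇒> k≰d

Deg-unique : ∀ {p a b} → Deg p a → Deg p b → a ≡ b
Deg-unique Da Db = ≤-antisym (≤-pred (Deg⇒< Da (below Db))) (≤-pred (Deg⇒< Db (below Da)))

¬Deg-zero : ∀ {p d} → p ≐ [] → ¬ Deg p d
¬Deg-zero {d = d} e D with () ← trans (sym (leading D)) (coeff-≡ e d)

Deg0⇒≐oneₚ : ∀ {p} → Deg p 0 → p ≐ oneₚ
Deg0⇒≐oneₚ D = coeffwise λ { zero → leading D ; (suc i) → vanishes (below D) (suc i) (s≤s z≤n) }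

Deg-∷ : ∀ b {p d} → Deg p d → Deg (b ∷ p) (suc d)
Deg-∷ b (degree lead bd) = degree lead (degBelow λ { (suc i) (s≤s d≤i) → vanishes bd i d≤i })

Deg-tail : ∀ {b p d} → Deg (b ∷ p) (suc d) → Deg p d
Deg-tail (degree lead bd) = degree lead (DegBelow-tail bd)

zero-or-Deg : ∀ p → p ≐ [] ⊎ ∃ (Deg p)
zero-or-Deg []      = inj₁ ≐-refl
zero-or-Deg (b ∷ p) with zero-or-Deg p
... | inj₂ (d , D) = inj₂ (suc d , Deg-∷ b D)
... | inj₁ p≐[]    with b
...   | false = inj₁ (coeffwise λ { zero → refl ; (suc i) → coeff-≡ p≐[] i })
...   | true  = inj₂ (0 , degree refl (degBelow λ { (suc i) _ → coeff-≡ p≐[] i }))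

Deg-+ₚ : ∀ {p q d} → DegBelow p d → Deg q d → Deg (p +ₚ q) d
Deg-+ₚ {p} {q} {d} bp (degree lead bq) = degree
  (trans (coeff-+ p q d) (cong₂ _xor_ (vanishes bp d ≤-refl) lead))
  (degBelow λ i d<i → trans (coeff-+ p q i) (cong₂ _xor_ (vanishes bp i (<⇒≤ d<i)) (vanishes bq i d<i)))

Deg-*ₚ : ∀ {p q a b} → Deg p a → Deg q b → Deg (p *ₚ q) (a + b)
Deg-*ₚ {[]}              Dp Dq = contradiction Dp (¬Deg-zero ≐-refl)
Deg-*ₚ {c ∷ p} {q} {zero} Dp Dq = Deg-resp (≐-sym (≐-trans (*ₚ-congˡ q (Deg0⇒≐oneₚ Dp)) (*ₚ-identityˡ q))) Dq
Deg-*ₚ {c ∷ p} {q} {suc a} {b} Dp Dq =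
  Deg-+ₚ (DegBelow-mono (s≤s (m≤n+m b a)) (DegBelow-scale c (below Dq)))
         (Deg-∷ false (Deg-*ₚ (Deg-tail Dp) Dq))

infix 4 _divides_
_divides_ : Poly → Poly → Set
g divides p = ∃ λ q → (q *ₚ g) ≐ p

∣ₚ⇒divides : ∀ {g p} → g ∣ₚ p → g divides p
∣ₚ⇒divides (q , e) = q , ≈ₚ⇒≐ e

divides⇒∣ₚ : ∀ {g p} → g divides p → g ∣ₚ p
divides⇒∣ₚ (q , e) = q , ≐⇒≈ₚ e

divides-refl : ∀ {g} → g divides g
divides-refl {g} = oneₚ , *ₚ-identityˡ g

divides-resp : ∀ {g p p'} → p ≐ p' → g divides p → g divides p'
divides-resp e (q , qg≐p) = q , ≐-trans qg≐p e

divides-zero : ∀ {g p} → p ≐ [] → g divides p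
divides-zero p≐[] = [] , ≐-sym p≐[]

divides-trans : ∀ {g h p} → g divides h → h divides p → g divides p
divides-trans {g} (q , qg≐h) (r , rh≐p) = r *ₚ q , ≐-trans (*ₚ-assoc r q g) (≐-trans (*ₚ-congʳ r qg≐h) rh≐p)

divides-+ₚ : ∀ {g p p'} → g divides p → g divides p' → g divides (p +ₚ p')
divides-+ₚ {g} (q , e) (q' , e') = q +ₚ q' , ≐-trans (*ₚ-distribʳ q q' g) (+ₚ-cong e e')

divides-*ₚ : ∀ {g p} r → g divides p → g divides (r *ₚ p)
divides-*ₚ {g} r (q , e) = r *ₚ q , ≐-trans (*ₚ-assoc r q g) (*ₚ-congʳ r e)

divides-X^· : ∀ {g p} k → g divides p → g divides (X^ k · p)
divides-X^· {g} k (q , e) = X^ k · q , ≐-trans (X^·-*ₚ k q g) (X^·-cong k e)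

divides-coeff0 : ∀ {g p} → g divides p → coeff p 0 ≡ true → coeff g 0 ≡ true
divides-coeff0 {g} (q , e) p0 = ∧-conicalʳ _ _ (trans (sym (coeff0-*ₚ q g)) (trans (coeff-≡ e 0) p0))

divides-X^·⁻¹ : ∀ {g p} k → coeff g 0 ≡ true → g divides (X^ k · p) → g divides p
divides-X^·⁻¹ zero    g0 d = d
divides-X^·⁻¹ {g} (suc k) g0 d = divides-X^·⁻¹ k g0 (cancel d)
  where
  cancel : ∀ {p} → g divides (false ∷ p) → g divides p
  cancel ([] , e) = [] , coeffwise (coeff-≡ e ∘ suc)
  cancel ((c ∷ q) , e) = q , ∷-injectiveʳ (≐-trans (≐-sym (≐-trans (*ₚ-congˡ g (∷-cong c≡false (≐-refl {q}))) (X*ₚ q g))) e)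
    where
    c≡false : c ≡ false
    c≡false = begin
      c                           ≡⟨ sym (∧-identityʳ c) ⟩
      c ∧ true                    ≡⟨ cong (c ∧_) (sym g0) ⟩
      c ∧ coeff g 0               ≡⟨ sym (coeff0-*ₚ (c ∷ q) g) ⟩
      coeff ((c ∷ q) *ₚ g) 0      ≡⟨ coeff-≡ e 0 ⟩
      false                       ∎
      where open ≡-Reasoning

multiple-of-smaller-degree : ∀ {g d r} → Deg g d → g divides r → DegBelow r d → r ≐ []
multiple-of-smaller-degree {g} {d} Dg (q , qg≐r) br with zero-or-Deg q
... | inj₁ q≐[]     = ≐-trans (≐-sym qg≐r) (*ₚ-congˡ g q≐[])
... | inj₂ (a , Dq) = contradiction (Deg⇒< (Deg-resp qg≐r (Deg-*ₚ Dq Dg)) br) (≤⇒≯ (m≤n+m d a))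

DivMod : Poly → Poly → ℕ → Set
DivMod p g d = ∃ λ q → ∃ λ r → (p ≐ (q *ₚ g) +ₚ r) × DegBelow r d

divMod : ∀ {g d} → Deg g d → ∀ p → DivMod p g d
divMod Dg []      = [] , [] , ≐-refl , degBelow λ _ _ → refl
divMod {g} {d} Dg (c ∷ p) with divMod Dg p
... | q , r , p≐qg+r , br = reduce (false ∷ q) (c ∷ r) c∷p≐ (degBelow λ { (suc i) (s≤s d≤i) → vanishes br i d≤i })
  where
  c∷p≐ : (c ∷ p) ≐ ((false ∷ q) *ₚ g) +ₚ (c ∷ r)
  c∷p≐ = ≐-trans (∷-cong refl p≐qg+r) (≐-sym (+ₚ-cong (X*ₚ q g) ≐-refl))
  reduce : ∀ q r → (c ∷ p) ≐ (q *ₚ g) +ₚ r → DegBelow r (suc d) → DivMod (c ∷ p) g d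
  reduce q r e br with coeff r d in rd
  ... | false = q , r , e , degBelow λ i d≤i → case m≤n⇒m<n∨m≡n d≤i of λ where
          (inj₁ d<i)  → vanishes br i d<i
          (inj₂ refl) → rd
  ... | true  = q +ₚ oneₚ , r +ₚ g , ≐-trans e (≐-sym cancel) , degBelow λ i d≤i →
          trans (coeff-+ r g i) (case m≤n⇒m<n∨m≡n d≤i of λ where
            (inj₁ d<i)  → cong₂ _xor_ (vanishes br i d<i) (vanishes (below Dg) i d<i)
            (inj₂ refl) → cong₂ _xor_ rd (leading Dg))
    where
    cancel : ((q +ₚ oneₚ) *ₚ g) +ₚ (r +ₚ g) ≐ (q *ₚ g) +ₚ r
    cancel = begin
      ((q +ₚ oneₚ) *ₚ g) +ₚ (r +ₚ g)       ≈⟨ +ₚ-cong (≐-trans (*ₚ-distribʳ q oneₚ g) (+ₚ-congˡ (q *ₚ g) (*ₚ-identityˡ g))) (+ₚ-comm r g) ⟩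
      ((q *ₚ g) +ₚ g) +ₚ (g +ₚ r)          ≈⟨ +ₚ-cancel-middle (q *ₚ g) g r ⟩
      (q *ₚ g) +ₚ r                        ∎
      where open ≐-Reasoning

divides? : ∀ {g d} → Deg g d → ∀ p → Dec (g divides p)
divides? {g} Dg p with divMod Dg p
... | q , r , p≐qg+r , br with zero-or-Deg r
...   | inj₁ r≐[] = yes (q , ≐-sym (≐-trans p≐qg+r (≐-trans (+ₚ-congˡ (q *ₚ g) r≐[]) (+ₚ-identityʳ _))))
...   | inj₂ (_ , Dr) = no λ g∣p → ¬Deg-zero (multiple-of-smaller-degree Dg (remainder-divisible g∣p) br) Dr
  where
  remainder-divisible : g divides p → g divides r
  remainder-divisible g∣p = divides-resp (≐-sym (+ₚ-solve p≐qg+r)) (divides-+ₚ g∣p (q , ≐-refl))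

-- Bézout identity, irreducible factors and orders

record Bezout (a b : Poly) : Set where
  field
    gcd      : Poly
    gcd∣a    : gcd divides a
    gcd∣b    : gcd divides b
    u v      : Poly
    identity : gcd ≐ (u *ₚ a) +ₚ (v *ₚ b)

bezout : ∀ a b → Bezout a b
bezout a b = euclid (length b) a b (DegBelow-length b)
  where
  euclid : ∀ n a b → DegBelow b n → Bezout a b
  euclid n a b bb with zero-or-Deg b
  ... | inj₁ b≐[] = record
    { gcd = a ; gcd∣a = divides-refl ; gcd∣b = divides-zero b≐[] ; u = oneₚ ; v = []
    ; identity = ≐-sym (≐-trans (+ₚ-identityʳ _) (*ₚ-identityˡ a)) }
  euclid zero    a b bb | inj₂ (e , Db) = contradiction (Deg⇒< Db bb) λ ()
  euclid (suc n) a b bb | inj₂ (e , Db) with divMod Db a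
  ... | q , r , a≐qb+r , br = record
    { gcd = gcd ; gcd∣a = gcd∣a′ ; gcd∣b = gcd∣a ; u = v ; v = u +ₚ (v *ₚ q) ; identity = identity′ }
    where
    open Bezout (euclid n b r (DegBelow-mono (≤-pred (Deg⇒< Db bb)) br))
    gcd∣a′ : gcd divides a
    gcd∣a′ = divides-resp (≐-sym a≐qb+r) (divides-+ₚ (divides-*ₚ q gcd∣a) gcd∣b)
    identity′ : gcd ≐ (v *ₚ a) +ₚ ((u +ₚ (v *ₚ q)) *ₚ b)
    identity′ = begin
      gcd                                           ≈⟨ identity ⟩
      (u *ₚ b) +ₚ (v *ₚ r)                          ≈⟨ +ₚ-congˡ (u *ₚ b) (*ₚ-congʳ v (+ₚ-solve a≐qb+r)) ⟩
      (u *ₚ b) +ₚ (v *ₚ (a +ₚ (q *ₚ b)))            ≈⟨ +ₚ-congˡ (u *ₚ b) (*ₚ-distribˡ v a (q *ₚ b)) ⟩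
      (u *ₚ b) +ₚ ((v *ₚ a) +ₚ (v *ₚ (q *ₚ b)))     ≈⟨ +ₚ-swap (u *ₚ b) (v *ₚ a) _ ⟩
      (v *ₚ a) +ₚ ((u *ₚ b) +ₚ (v *ₚ (q *ₚ b)))     ≈⟨ +ₚ-congˡ (v *ₚ a) (+ₚ-congˡ (u *ₚ b) (≐-sym (*ₚ-assoc v q b))) ⟩
      (v *ₚ a) +ₚ ((u *ₚ b) +ₚ ((v *ₚ q) *ₚ b))     ≈⟨ +ₚ-congˡ (v *ₚ a) (≐-sym (*ₚ-distribʳ u (v *ₚ q) b)) ⟩
      (v *ₚ a) +ₚ ((u +ₚ (v *ₚ q)) *ₚ b)            ∎
      where open ≐-Reasoning

Nonconstant : Poly → Set
Nonconstant p = ∃ λ k → Deg p (suc k)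

nonconstant? : ∀ p → Dec (Nonconstant p)
nonconstant? p with zero-or-Deg p
... | inj₁ p≐[]        = no λ (_ , D) → ¬Deg-zero p≐[] D
... | inj₂ (zero , D)  = no λ (_ , D′) → 0≢1+n (Deg-unique D D′)
... | inj₂ (suc k , D) = yes (k , D)

norm-≐ : ∀ p → norm p ≐ p
norm-≐ p = coeffwise (coeff-norm p)

Nonconstant⇒1<length : ∀ {p} → Nonconstant p → 1 < length (norm p)
Nonconstant⇒1<length {p} (k , D) = ≤-trans (s≤s (s≤s z≤n)) (Deg⇒< (Deg-resp (≐-sym (norm-≐ p)) D) (DegBelow-length (norm p)))

Irreducible⇒Nonconstant : ∀ {g} → Irreducible g → Nonconstant g
Irreducible⇒Nonconstant {g} (1<len , _) with zero-or-Deg g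
... | inj₁ g≐[]        = contradiction (subst (λ l → 1 < length l) (≐⇒≈ₚ g≐[]) 1<len) λ ()
... | inj₂ (zero , D)  = contradiction (subst (λ l → 1 < length l) (≐⇒≈ₚ (Deg0⇒≐oneₚ D)) 1<len) λ { (s≤s ()) }
... | inj₂ (suc k , D) = k , D

coeffVec : (n : ℕ) → Poly → Vec Bool n
coeffVec zero    p       = Vec.[]
coeffVec (suc n) []      = false Vec.∷ coeffVec n []
coeffVec (suc n) (b ∷ p) = b Vec.∷ coeffVec n p

toList-coeffVec : ∀ n {p} → DegBelow p n → toList (coeffVec n p) ≐ p
toList-coeffVec zero    bp = ≐-sym (DegBelow-zero bp)
toList-coeffVec (suc n) {[]}    bp = coeffwise λ { zero → refl ; (suc i) → coeff-≡ (toList-coeffVec n (degBelow λ _ _ → refl)) i }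
toList-coeffVec (suc n) {b ∷ p} bp = ∷-cong refl (toList-coeffVec n (DegBelow-tail bp))

nonconstant-divisor? : ∀ d p → Dec (Nonconstant p × p divides d)
nonconstant-divisor? d p with nonconstant? p
... | no ¬nc      = no (¬nc ∘ proj₁)
... | yes (k , D) = map′ ((k , D) ,_) proj₂ (divides? D d)

-- Subset (suc e) is Vec Bool (suc e), so anySubset? searches all polynomials of degree ≤ e.
irreducible-or-factor : ∀ {d e} → Deg d (suc e) →
  Irreducible d ⊎ ∃ λ p → ∃ λ k → k < e × Deg p (suc k) × p divides d
irreducible-or-factor {d} {e} Dd with anySubset? (nonconstant-divisor? d ∘ toList)
... | yes (v , (k , Dp) , p∣d) = inj₂ (toList v , k , k<e , Dp , p∣d)
  where
  k<e : k < e
  k<e = ≤-pred (Deg⇒< Dp (subst (DegBelow (toList v)) (length-toList v) (DegBelow-length (toList v))))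
... | no noFactor = inj₁ (Nonconstant⇒1<length (e , Dd) , factors-trivial)
  where
  factors-trivial : ∀ p q → (p *ₚ q) ≈ₚ d → p ≈ₚ oneₚ ⊎ q ≈ₚ oneₚ
  factors-trivial p q pq≈d with zero-or-Deg p | zero-or-Deg q
  ... | inj₁ p≐[] | _ = contradiction Dd (¬Deg-zero (≐-trans (≐-sym (≈ₚ⇒≐ pq≈d)) (*ₚ-congˡ q p≐[])))
  ... | inj₂ _ | inj₁ q≐[] = contradiction Dd (¬Deg-zero (≐-trans (≐-sym (≈ₚ⇒≐ pq≈d)) (≐-trans (*ₚ-congʳ p q≐[]) (*ₚ-zeroʳ p))))
  ... | inj₂ (zero , Dp) | _ = inj₁ (≐⇒≈ₚ (Deg0⇒≐oneₚ Dp))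
  ... | inj₂ (suc a , Dp) | inj₂ (zero , Dq) = inj₂ (≐⇒≈ₚ (Deg0⇒≐oneₚ Dq))
  ... | inj₂ (suc a , Dp) | inj₂ (suc b , Dq) = contradiction (coeffVec (suc e) p , (a , Deg-resp (≐-sym p≐) Dp) , p∣d) noFactor
    where
    a<e : suc a < suc e
    a<e = subst (suc a <_) (Deg-unique (Deg-resp (≈ₚ⇒≐ pq≈d) (Deg-*ₚ Dp Dq)) Dd) (m<m+n (suc a) (s≤s z≤n))
    p≐ : toList (coeffVec (suc e) p) ≐ p
    p≐ = toList-coeffVec (suc e) (DegBelow-mono a<e (below Dp))
    p∣d : toList (coeffVec (suc e) p) divides d
    p∣d = q , ≐-trans (*ₚ-congʳ q p≐) (≐-trans (*ₚ-comm q p) (≈ₚ⇒≐ pq≈d))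

irreducible-factor : ∀ {d e} → Deg d (suc e) → ∃ λ g → Irreducible g × g divides d
irreducible-factor {e = e} = <-rec (λ e → ∀ {d} → Deg d (suc e) → ∃ λ g → Irreducible g × g divides d) step e
  where
  step : ∀ e → (∀ {k} → k < e → ∀ {p} → Deg p (suc k) → ∃ λ g → Irreducible g × g divides p) →
         ∀ {d} → Deg d (suc e) → ∃ λ g → Irreducible g × g divides d
  step e smaller Dd with irreducible-or-factor Dd
  ... | inj₁ irr = _ , irr , divides-refl
  ... | inj₂ (p , k , k<e , Dp , p∣d) with smaller k<e Dp
  ...   | g , irr , g∣p = g , irr , divides-trans g∣p p∣d

least-witness : ∀ {P : ℕ → Set} → Decidable P → ∀ {n} → P n → ∃ λ ℓ → P ℓ × (∀ k → k < ℓ → ¬ P k)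
least-witness {P} P? {n} Pn = search n 0 refl λ _ ()
  where
  search : ∀ j i → i + j ≡ n → (∀ k → k < i → ¬ P k) → ∃ λ ℓ → P ℓ × (∀ k → k < ℓ → ¬ P k)
  search j i i+j≡n below with P? i
  ... | yes Pi = i , Pi , below
  search zero    i i+j≡n below | no ¬Pi = contradiction (subst P (trans (sym i+j≡n) (+-identityʳ i)) Pn) ¬Pi
  search (suc j) i i+j≡n below | no ¬Pi = search j (suc i) (trans (sym (+-suc i j)) i+j≡n) λ k k<1+i →
    case m≤n⇒m<n∨m≡n (≤-pred k<1+i) of λ where
      (inj₁ k<i)  → below k k<i
      (inj₂ refl) → ¬Pi

divides-xPow+1-* : ∀ {g ℓ} q → g divides xPow+1 ℓ → g divides xPow+1 (q * ℓ)
divides-xPow+1-* zero    _   = divides-zero (coeffwise λ { zero → refl ; (suc i) → refl })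
divides-xPow+1-* {ℓ = ℓ} (suc q) g∣T =
  divides-resp (≐-sym (xPow+1-+ ℓ (q * ℓ))) (divides-+ₚ (divides-X^· ℓ (divides-xPow+1-* q g∣T)) g∣T)

divides-xPow+1-+ : ∀ {g} a b → g divides xPow+1 b → g divides xPow+1 (a + b) → g divides xPow+1 a
divides-xPow+1-+ a b g∣Tb g∣Ta+b =
  divides-resp (≐-sym (+ₚ-solve (xPow+1-+ a b))) (divides-+ₚ g∣Ta+b (divides-X^· a g∣Tb))

order-divides : ∀ {g ℓ h} → 1 ≤ ℓ → g divides xPow+1 ℓ →
  (∀ k → 1 ≤ k → k < ℓ → ¬ g divides xPow+1 k) → g divides xPow+1 h → ℓ ∣ h
order-divides {g} {ℓ@(suc _)} {h} _ g∣Tℓ minimal g∣Th = m%n≡0⇒n∣m h ℓ (remainder≡0 (h % ℓ) (m%n<n h ℓ) g∣Tr)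
  where
  g∣Tr : g divides xPow+1 (h % ℓ)
  g∣Tr = divides-xPow+1-+ (h % ℓ) _ (divides-xPow+1-* (h / ℓ) g∣Tℓ)
           (subst (λ n → g divides xPow+1 n) (m≡m%n+[m/n]*n h ℓ) g∣Th)
  remainder≡0 : ∀ r → r < ℓ → g divides xPow+1 r → r ≡ 0
  remainder≡0 zero    _   _   = refl
  remainder≡0 (suc r) r<ℓ g∣T = contradiction g∣T (minimal (suc r) (s≤s z≤n) r<ℓ)

order-exists : ∀ {g d h} → Deg g d → 1 ≤ h → g divides xPow+1 h → ∃ λ ℓ → IsOrd g ℓ × ℓ ∣ h
order-exists {g} Dg 1≤h g∣Th with least-witness (λ k → (1 ≤? k) ×-dec divides? Dg (xPow+1 k)) (1≤h , g∣Th)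
... | ℓ , (1≤ℓ , g∣Tℓ) , below = ℓ , (1≤ℓ , divides⇒∣ₚ g∣Tℓ , λ k 1≤k k<ℓ → minimal k 1≤k k<ℓ ∘ ∣ₚ⇒divides)
                                , order-divides 1≤ℓ g∣Tℓ minimal g∣Th
  where
  minimal : ∀ k → 1 ≤ k → k < ℓ → ¬ g divides xPow+1 k
  minimal k 1≤k k<ℓ g∣Tk = below k k<ℓ (1≤k , g∣Tk)

-- The shift-invariant maps Σ cₖ γ₂ₖ

Seq : Set
Seq = ℕ → Bool

infixl 8 _≫_
_≫_ : Seq → ℕ → Seq
(w ≫ k) i = w (k + i)

-- γ k w is γ₂ₖ(w) at position 0; oddPrefix multiplies from the top, as oddNegs does.
oddPrefix : ℕ → Seq → Bool
oddPrefix zero    w = true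
oddPrefix (suc k) w = not (w (k + suc k)) ∧ oddPrefix k w

γ : ℕ → Seq → Bool
γ k w = w (k + k) ∧ oddPrefix k w

-- rule C w = Σₖ cₖ γ k w, in Horner form: γ (k + 1) w = ¬ w 1 ∧ γ k (w ≫ 2).
rule : Poly → Seq → Bool
rule []      w = false
rule (c ∷ C) w = (c ∧ w 0) xor (not (w 1) ∧ rule C (w ≫ 2))

Γ : Poly → Seq → Seq
Γ C w k = rule C (w ≫ k)

oddPrefix-ext : ∀ k {w w'} → w ≗ w' → oddPrefix k w ≡ oddPrefix k w'
oddPrefix-ext zero    e = refl
oddPrefix-ext (suc k) e = cong₂ _∧_ (cong not (e _)) (oddPrefix-ext k e)

γ-ext : ∀ k {w w'} → w ≗ w' → γ k w ≡ γ k w'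
γ-ext k e = cong₂ _∧_ (e (k + k)) (oddPrefix-ext k e)

rule-ext : ∀ C {w w'} → w ≗ w' → rule C w ≡ rule C w'
rule-ext []      e = refl
rule-ext (c ∷ C) e = cong₂ _xor_ (cong (c ∧_) (e 0)) (cong₂ _∧_ (cong not (e 1)) (rule-ext C (e ∘ (2 +_))))

oddPrefix-suc : ∀ k w → oddPrefix (suc k) w ≡ not (w 1) ∧ oddPrefix k (w ≫ 2)
oddPrefix-suc zero    w = refl
oddPrefix-suc (suc k) w = begin
  not (w (suc k + suc (suc k))) ∧ oddPrefix (suc k) w
    ≡⟨ cong₂ _∧_ (cong (not ∘ w ∘ suc) (+-suc k (suc k))) (oddPrefix-suc k w) ⟩
  not (w (2 + (k + suc k))) ∧ (not (w 1) ∧ oddPrefix k (w ≫ 2))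
    ≡⟨ ∧-swap (not (w (2 + (k + suc k)))) (not (w 1)) _ ⟩
  not (w 1) ∧ oddPrefix (suc k) (w ≫ 2) ∎
  where open ≡-Reasoning

γ-suc : ∀ k w → γ (suc k) w ≡ not (w 1) ∧ γ k (w ≫ 2)
γ-suc k w = begin
  w (suc k + suc k) ∧ oddPrefix (suc k) w
    ≡⟨ cong₂ _∧_ (cong (w ∘ suc) (+-suc k k)) (oddPrefix-suc k w) ⟩
  w (2 + (k + k)) ∧ (not (w 1) ∧ oddPrefix k (w ≫ 2))
    ≡⟨ ∧-swap (w (2 + (k + k))) (not (w 1)) _ ⟩
  not (w 1) ∧ γ k (w ≫ 2) ∎
  where open ≡-Reasoning

oddPrefix-+ : ∀ j k w → oddPrefix (j + k) w ≡ oddPrefix j w ∧ oddPrefix k (w ≫ (j + j))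
oddPrefix-+ zero    k w = oddPrefix-ext k λ _ → refl
oddPrefix-+ (suc j) k w = begin
  oddPrefix (suc (j + k)) w
    ≡⟨ oddPrefix-suc (j + k) w ⟩
  not (w 1) ∧ oddPrefix (j + k) (w ≫ 2)
    ≡⟨ cong (not (w 1) ∧_) (oddPrefix-+ j k (w ≫ 2)) ⟩
  not (w 1) ∧ (oddPrefix j (w ≫ 2) ∧ oddPrefix k (w ≫ 2 ≫ (j + j)))
    ≡⟨ sym (∧-assoc (not (w 1)) _ _) ⟩
  (not (w 1) ∧ oddPrefix j (w ≫ 2)) ∧ oddPrefix k (w ≫ 2 ≫ (j + j))
    ≡⟨ cong₂ _∧_ (sym (oddPrefix-suc j w)) (oddPrefix-ext k λ i → cong (w ∘ suc) (sym (cong (_+ i) (+-suc j j)))) ⟩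
  oddPrefix (suc j) w ∧ oddPrefix k (w ≫ (suc j + suc j)) ∎
  where open ≡-Reasoning

oddPrefix-intro : ∀ k w → (∀ j → j < k → w (suc (j + j)) ≡ false) → oddPrefix k w ≡ true
oddPrefix-intro zero    w _   = refl
oddPrefix-intro (suc k) w odd = cong₂ _∧_
  (cong not (trans (cong w (+-suc k k)) (odd k ≤-refl)))
  (oddPrefix-intro k w λ j j<k → odd j (m<n⇒m<1+n j<k))

γ-+ : ∀ j k w → γ (j + k) w ≡ oddPrefix j w ∧ γ k (w ≫ (j + j))
γ-+ j k w = begin
  w ((j + k) + (j + k)) ∧ oddPrefix (j + k) w
    ≡⟨ cong₂ _∧_ (cong w (ℕ-interchange j k j k)) (oddPrefix-+ j k w) ⟩
  w ((j + j) + (k + k)) ∧ (oddPrefix j w ∧ oddPrefix k (w ≫ (j + j)))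
    ≡⟨ ∧-swap (w ((j + j) + (k + k))) (oddPrefix j w) _ ⟩
  oddPrefix j w ∧ γ k (w ≫ (j + j)) ∎
  where open ≡-Reasoning

rule-zero : ∀ {C} w → C ≐ [] → rule C w ≡ false
rule-zero {[]}    w e = refl
rule-zero {c ∷ C} w e = begin
  (c ∧ w 0) xor (not (w 1) ∧ rule C (w ≫ 2))   ≡⟨ cong₂ (λ c r → (c ∧ w 0) xor (not (w 1) ∧ r)) (coeff-≡ e 0) (rule-zero {C} (w ≫ 2) (coeffwise (coeff-≡ e ∘ suc))) ⟩
  not (w 1) ∧ false                            ≡⟨ ∧-zeroʳ _ ⟩
  false                                        ∎
  where open ≡-Reasoning

rule-cong : ∀ {C D} w → C ≐ D → rule C w ≡ rule D w
rule-cong {[]}    w e = sym (rule-zero w (≐-sym e))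
rule-cong {c ∷ C} {[]}    w e = rule-zero w e
rule-cong {c ∷ C} {d ∷ D} w e =
  cong₂ (λ c r → (c ∧ w 0) xor (not (w 1) ∧ r)) (coeff-≡ e 0) (rule-cong (w ≫ 2) (∷-injectiveʳ e))

rule-+ₚ : ∀ P Q w → rule (P +ₚ Q) w ≡ rule P w xor rule Q w
rule-+ₚ []      Q       w = refl
rule-+ₚ (a ∷ P) []      w = sym (xor-identityʳ _)
rule-+ₚ (a ∷ P) (b ∷ Q) w = begin
  ((a xor b) ∧ w 0) xor (not (w 1) ∧ rule (P +ₚ Q) (w ≫ 2))
    ≡⟨ cong₂ _xor_ (∧-distribʳ-xor (w 0) a b) (trans (cong (not (w 1) ∧_) (rule-+ₚ P Q (w ≫ 2))) (∧-distribˡ-xor (not (w 1)) _ _)) ⟩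
  ((a ∧ w 0) xor (b ∧ w 0)) xor ((not (w 1) ∧ rule P (w ≫ 2)) xor (not (w 1) ∧ rule Q (w ≫ 2)))
    ≡⟨ xor-interchange (a ∧ w 0) _ _ _ ⟩
  rule (a ∷ P) w xor rule (b ∷ Q) w ∎
  where open ≡-Reasoning

rule-scale : ∀ b P w → rule (scale b P) w ≡ b ∧ rule P w
rule-scale b []      w = sym (∧-zeroʳ b)
rule-scale b (a ∷ P) w = begin
  ((b ∧ a) ∧ w 0) xor (not (w 1) ∧ rule (scale b P) (w ≫ 2))
    ≡⟨ cong₂ _xor_ (∧-assoc b a (w 0)) (trans (cong (not (w 1) ∧_) (rule-scale b P (w ≫ 2))) (∧-swap (not (w 1)) b _)) ⟩
  (b ∧ (a ∧ w 0)) xor (b ∧ (not (w 1) ∧ rule P (w ≫ 2)))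
    ≡⟨ sym (∧-distribˡ-xor b _ _) ⟩
  b ∧ rule (a ∷ P) w ∎
  where open ≡-Reasoning

rule-X^·-∷ : ∀ k a A w → rule (X^ k · (a ∷ A)) w ≡ (a ∧ γ k w) xor rule (X^ suc k · A) w
rule-X^·-∷ zero    a A w = cong (λ x → (a ∧ x) xor (not (w 1) ∧ rule A (w ≫ 2))) (sym (∧-identityʳ (w 0)))
rule-X^·-∷ (suc k) a A w = begin
  not (w 1) ∧ rule (X^ k · (a ∷ A)) (w ≫ 2)
    ≡⟨ cong (not (w 1) ∧_) (rule-X^·-∷ k a A (w ≫ 2)) ⟩
  not (w 1) ∧ ((a ∧ γ k (w ≫ 2)) xor rule (X^ suc k · A) (w ≫ 2))
    ≡⟨ ∧-distribˡ-xor (not (w 1)) _ _ ⟩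
  (not (w 1) ∧ (a ∧ γ k (w ≫ 2))) xor (not (w 1) ∧ rule (X^ suc k · A) (w ≫ 2))
    ≡⟨ cong (_xor _) (trans (∧-swap (not (w 1)) a _) (cong (a ∧_) (sym (γ-suc k w)))) ⟩
  (a ∧ γ (suc k) w) xor rule (X^ suc (suc k) · A) w ∎
  where open ≡-Reasoning

rule-X^·-one : ∀ k w → rule (X^ k · oneₚ) w ≡ γ k w
rule-X^·-one k w = trans (rule-X^·-∷ k true [] w) (trans (cong (γ k w xor_) (rule-zero w (X^·-[] (suc k)))) (xor-identityʳ _))

rule-vanishes : ∀ {C k} w → DegBelow C k → (∀ i → i < k → w (i + i) ≡ false) → rule C w ≡ false
rule-vanishes {[]}            w bC even = refl
rule-vanishes {c ∷ C} {zero}  w bC even = rule-zero w (DegBelow-zero bC)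
rule-vanishes {c ∷ C} {suc k} w bC even = begin
  (c ∧ w 0) xor (not (w 1) ∧ rule C (w ≫ 2))   ≡⟨ cong₂ (λ x r → (c ∧ x) xor (not (w 1) ∧ r)) (even 0 (s≤s z≤n)) rest ⟩
  (c ∧ false) xor (not (w 1) ∧ false)          ≡⟨ cong₂ _xor_ (∧-zeroʳ c) (∧-zeroʳ _) ⟩
  false                                        ∎
  where
  open ≡-Reasoning
  rest : rule C (w ≫ 2) ≡ false
  rest = rule-vanishes (w ≫ 2) (DegBelow-tail bC) λ i i<k → trans (cong (w ∘ suc) (sym (+-suc i i))) (even (suc i) (s≤s i<k))

-- A 1 at an odd position preceded only by 0s at even positions kills every γ k.
rule-blocked : ∀ A D w → not (w 0) ∧ rule A (w ≫ 1) ≡ true → rule D w ≡ false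
rule-blocked A       []      w h = refl
rule-blocked []      (d ∷ D) w h = contradiction (trans (sym (∧-zeroʳ (not (w 0)))) h) λ ()
rule-blocked (a ∷ A) (d ∷ D) w h with w 0 | w 1
... | true  | _     = contradiction h λ ()
... | false | true  = trans (xor-identityʳ _) (∧-zeroʳ d)
... | false | false = cong₂ _xor_ (∧-zeroʳ d) (rule-blocked A D (w ≫ 2) (trans (sym (cong (_xor _) (∧-zeroʳ a))) h))

not-xor-∧ : ∀ x n y → (n ≡ true → y ≡ false) → not (x xor n) ∧ y ≡ not x ∧ y
not-xor-∧ x false y _    = cong (λ t → not t ∧ y) (xor-identityʳ x)
not-xor-∧ x true  y n⇒¬y rewrite n⇒¬y refl = trans (∧-zeroʳ _) (sym (∧-zeroʳ _))

rule-∘ : ∀ B {A} → coeff A 0 ≡ true → ∀ w → rule B (Γ A w) ≡ rule (B *ₚ A) w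
rule-∘ B       {[]}        () w
rule-∘ B       {false ∷ A} () w
rule-∘ []      {true ∷ A}  _  w = refl
rule-∘ (b ∷ B) {true ∷ A}  a0 w = begin
  (b ∧ rule A′ w) xor (not (w 1 xor N) ∧ rule B (Γ A′ (w ≫ 2)))
    ≡⟨ cong (λ r → (b ∧ rule A′ w) xor (not (w 1 xor N) ∧ r)) (rule-∘ B a0 (w ≫ 2)) ⟩
  (b ∧ rule A′ w) xor (not (w 1 xor N) ∧ rule (B *ₚ A′) (w ≫ 2))
    ≡⟨ cong ((b ∧ rule A′ w) xor_) (not-xor-∧ (w 1) N _ (rule-blocked A (B *ₚ A′) (w ≫ 2))) ⟩
  (b ∧ rule A′ w) xor rule (false ∷ (B *ₚ A′)) w
    ≡⟨ cong (_xor rule (false ∷ (B *ₚ A′)) w) (sym (rule-scale b A′ w)) ⟩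
  rule (scale b A′) w xor rule (false ∷ (B *ₚ A′)) w
    ≡⟨ sym (rule-+ₚ (scale b A′) (false ∷ (B *ₚ A′)) w) ⟩
  rule ((b ∷ B) *ₚ A′) w ∎
  where
  open ≡-Reasoning
  A′ = true ∷ A
  N  = not (w 2) ∧ rule A (w ≫ 3)

Γ-≫ : ∀ C w k → Γ C w ≫ k ≗ Γ C (w ≫ k)
Γ-≫ C w k i = rule-ext C λ j → cong w (+-assoc k i j)

Γ-ext : ∀ C {w w'} → w ≗ w' → Γ C w ≗ Γ C w'
Γ-ext C e k = rule-ext C (e ∘ (k +_))

Γ-cong : ∀ {C D} → C ≐ D → ∀ w → Γ C w ≗ Γ D w
Γ-cong e w k = rule-cong (w ≫ k) e

Γ-∘ : ∀ B {A} → coeff A 0 ≡ true → ∀ w → Γ B (Γ A w) ≗ Γ (B *ₚ A) w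
Γ-∘ B {A} a0 w k = trans (rule-ext B (Γ-≫ A w k)) (rule-∘ B a0 (w ≫ k))

rule-one : ∀ w → rule oneₚ w ≡ w 0
rule-one w = trans (cong (w 0 xor_) (∧-zeroʳ _)) (xor-identityʳ _)

rule-false : ∀ C → rule C (λ _ → false) ≡ false
rule-false []      = refl
rule-false (c ∷ C) = cong₂ _xor_ (∧-zeroʳ c) (rule-false C)

-- Periodic sequences and vectors

Periodic : ℕ → Seq → Set
Periodic n w = ∀ i → w (n + i) ≡ w i

Periodic-≫ : ∀ {n w} c → Periodic n w → Periodic n (w ≫ c)
Periodic-≫ {n} {w} c per i = trans (cong w (ℕ-swap c n i)) (per (c + i))

Γ-periodic : ∀ C {n w} → Periodic n w → Periodic n (Γ C w)
Γ-periodic C {n} {w} per i = rule-ext C λ j → trans (cong w (+-assoc n i j)) (per (i + j))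

Periodic-* : ∀ {n w} → Periodic n w → ∀ k i → w (k * n + i) ≡ w i
Periodic-* per zero    i = refl
Periodic-* {n} {w} per (suc k) i = trans (cong w (+-assoc n (k * n) i)) (trans (per (k * n + i)) (Periodic-* per k i))

Periodic-∣ : ∀ {d n w} → d ∣ n → Periodic d w → Periodic n w
Periodic-∣ (ℕ.divides k refl) per = Periodic-* per k

Periodic-% : ∀ {m w} → Periodic (suc m) w → ∀ i → w (i % suc m) ≡ w i
Periodic-% {m} {w} per i = begin
  w (i % suc m)                              ≡⟨ sym (Periodic-* per (i / suc m) (i % suc m)) ⟩
  w (i / suc m * suc m + i % suc m)          ≡⟨ cong w (+-comm (i / suc m * suc m) (i % suc m)) ⟩
  w (i % suc m + i / suc m * suc m)          ≡⟨ cong w (sym (m≡m%n+[m/n]*n i (suc m))) ⟩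
  w i                                        ∎
  where open ≡-Reasoning

Annihilates : Poly → ℕ → Set
Annihilates M n = ∀ w → Periodic n w → rule M w ≡ false

annihilates-*ₚ : ∀ {M n} → Annihilates M n → ∀ D → Annihilates (D *ₚ M) n
annihilates-*ₚ ann []      w per = refl
annihilates-*ₚ {M} ann (d ∷ D) w per = begin
  rule (scale d M +ₚ (false ∷ (D *ₚ M))) w
    ≡⟨ rule-+ₚ (scale d M) (false ∷ (D *ₚ M)) w ⟩
  rule (scale d M) w xor (not (w 1) ∧ rule (D *ₚ M) (w ≫ 2))
    ≡⟨ cong₂ _xor_ (trans (rule-scale d M w) (cong (d ∧_) (ann w per))) (cong (not (w 1) ∧_) (annihilates-*ₚ ann D (w ≫ 2) (Periodic-≫ 2 per))) ⟩
  (d ∧ false) xor (not (w 1) ∧ false)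
    ≡⟨ cong₂ _xor_ (∧-zeroʳ d) (∧-zeroʳ _) ⟩
  false ∎
  where open ≡-Reasoning

-- For odd n = 2r + 1, w (2r + 2) = w 1 while γ (r + 1) w contains the factor ¬ w 1.
annihilates-odd : ∀ r → Annihilates (X^ suc r · oneₚ) (suc (r + r))
annihilates-odd r w per = begin
  rule (X^ suc r · oneₚ) w                              ≡⟨ trans (rule-X^·-one (suc r) w) (γ-suc r w) ⟩
  not (w 1) ∧ (w (2 + (r + r)) ∧ oddPrefix r (w ≫ 2))   ≡⟨ cong (λ x → not (w 1) ∧ (x ∧ oddPrefix r (w ≫ 2))) w₂ᵣ₊₂≡w₁ ⟩
  not (w 1) ∧ (w 1 ∧ oddPrefix r (w ≫ 2))               ≡⟨ ¬x∧x∧y (w 1) _ ⟩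
  false                                                 ∎
  where
  open ≡-Reasoning
  w₂ᵣ₊₂≡w₁ : w (2 + (r + r)) ≡ w 1
  w₂ᵣ₊₂≡w₁ = trans (cong w (+-comm 1 (suc (r + r)))) (per 1)
  ¬x∧x∧y : ∀ x y → not x ∧ (x ∧ y) ≡ false
  ¬x∧x∧y true  y = refl
  ¬x∧x∧y false y = refl

-- For n = 2h, γ (2h) and γ h agree on n-periodic sequences.
annihilates-even : ∀ h → Annihilates (X^ h · xPow+1 h) (h + h)
annihilates-even h w per = begin
  rule (X^ h · ((X^ h · oneₚ) +ₚ oneₚ)) w
    ≡⟨ cong (λ p → rule p w) (X^·-+ₚ h (X^ h · oneₚ) oneₚ) ⟩
  rule ((X^ h · X^ h · oneₚ) +ₚ (X^ h · oneₚ)) w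
    ≡⟨ rule-+ₚ (X^ h · X^ h · oneₚ) (X^ h · oneₚ) w ⟩
  rule (X^ h · X^ h · oneₚ) w xor rule (X^ h · oneₚ) w
    ≡⟨ cong₂ _xor_ (trans (cong (λ p → rule p w) (sym (X^-+ h h oneₚ))) (rule-X^·-one (h + h) w)) (rule-X^·-one h w) ⟩
  γ (h + h) w xor γ h w
    ≡⟨ cong (_xor γ h w) (trans (γ-+ h h w) (cong (oddPrefix h w ∧_) (γ-ext h per))) ⟩
  (oddPrefix h w ∧ γ h w) xor γ h w
    ≡⟨ cong (_xor γ h w) (x∧[y∧x]≡y∧x (oddPrefix h w) (w (h + h))) ⟩
  γ h w xor γ h w
    ≡⟨ xor-same (γ h w) ⟩
  false ∎
  where
  open ≡-Reasoning
  x∧[y∧x]≡y∧x : ∀ x y → x ∧ (y ∧ x) ≡ y ∧ x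
  x∧[y∧x]≡y∧x true  y = refl
  x∧[y∧x]≡y∧x false y = sym (∧-zeroʳ y)

-- Chosen so that lookup x (shiftIdx k j) is definitionally toSeq x (toℕ j + k).
toSeq : ∀ {m} → Vec Bool (suc m) → Seq
toSeq {m} x i = lookup x (fromℕ< (m%n<n i (suc m)))

fromSeq : ∀ {m} → Seq → Vec Bool (suc m)
fromSeq w = tabulate (w ∘ toℕ)

toSeq-toℕ : ∀ {m} (x : Vec Bool (suc m)) j → toSeq x (toℕ j) ≡ lookup x j
toSeq-toℕ {m} x j = cong (lookup x) (toℕ-injective (trans (toℕ-fromℕ< _) (m<n⇒m%n≡m (toℕ<n j))))

toSeq-periodic : ∀ {m} (x : Vec Bool (suc m)) → Periodic (suc m) (toSeq x)
toSeq-periodic {m} x i = cong (lookup x) (fromℕ<-cong _ _ (%-remove-+ˡ {suc m} i ∣-refl) _ _)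

fromSeq-toSeq : ∀ {m} (x : Vec Bool (suc m)) → fromSeq (toSeq x) ≡ x
fromSeq-toSeq x = trans (tabulate-cong (toSeq-toℕ x)) (tabulate∘lookup x)

toSeq-fromSeq : ∀ {m w} → Periodic (suc m) w → toSeq {m} (fromSeq w) ≗ w
toSeq-fromSeq {m} {w} per i = begin
  lookup (tabulate (w ∘ toℕ)) (fromℕ< (m%n<n i (suc m)))   ≡⟨ lookup∘tabulate (w ∘ toℕ) _ ⟩
  w (toℕ (fromℕ< (m%n<n i (suc m))))                      ≡⟨ cong w (toℕ-fromℕ< _) ⟩
  w (i % suc m)                                           ≡⟨ Periodic-% per i ⟩
  w i                                                     ∎
  where open ≡-Reasoning

fromSeq-ext : ∀ {m w w'} → w ≗ w' → fromSeq {m} w ≡ fromSeq w'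
fromSeq-ext e = tabulate-cong (e ∘ toℕ)

Φ : ∀ {m} → Poly → Vec Bool (suc m) → Vec Bool (suc m)
Φ C x = fromSeq (Γ C (toSeq x))

Φ-fromSeq : ∀ {m} C {w} → Periodic (suc m) w → Φ C (fromSeq {m} w) ≡ fromSeq (Γ C w)
Φ-fromSeq C per = fromSeq-ext (Γ-ext C (toSeq-fromSeq per))

Φ-∘ : ∀ {m} B {A} → coeff A 0 ≡ true → (x : Vec Bool (suc m)) → Φ B (Φ A x) ≡ Φ (B *ₚ A) x
Φ-∘ {m} B {A} a0 x = trans (Φ-fromSeq B (Γ-periodic A {suc m} (toSeq-periodic x))) (fromSeq-ext (Γ-∘ B a0 (toSeq x)))

Φ-identity : ∀ {m M C} → Annihilates M (suc m) → ∀ D → C ≐ oneₚ +ₚ (D *ₚ M) → (x : Vec Bool (suc m)) → Φ C x ≡ x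
Φ-identity {M = M} {C} ann D C≐ x = trans (fromSeq-ext pointwise) (fromSeq-toSeq x)
  where
  pointwise : Γ C (toSeq x) ≗ toSeq x
  pointwise k = begin
    rule C (toSeq x ≫ k)                                                  ≡⟨ rule-cong (toSeq x ≫ k) C≐ ⟩
    rule (oneₚ +ₚ (D *ₚ M)) (toSeq x ≫ k)                                 ≡⟨ rule-+ₚ oneₚ (D *ₚ M) (toSeq x ≫ k) ⟩
    rule oneₚ (toSeq x ≫ k) xor rule (D *ₚ M) (toSeq x ≫ k)               ≡⟨ cong₂ _xor_ (rule-one (toSeq x ≫ k)) (annihilates-*ₚ ann D _ (Periodic-≫ k (toSeq-periodic x))) ⟩
    toSeq x (k + 0) xor false                                             ≡⟨ trans (xor-identityʳ _) (cong (toSeq x) (+-identityʳ k)) ⟩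
    toSeq x k                                                             ∎
    where open ≡-Reasoning

oddNegs≡oddPrefix : ∀ {m} k (x : Vec Bool (suc m)) j → oddNegs k x j ≡ oddPrefix k (toSeq x ≫ toℕ j)
oddNegs≡oddPrefix zero    x j = refl
oddNegs≡oddPrefix (suc k) x j = cong (not (lookup x (shiftIdx (k + suc k) j)) ∧_) (oddNegs≡oddPrefix k x j)

γ₂≡γ : ∀ {m} k (x : Vec Bool (suc m)) j → lookup (γ₂ k x) j ≡ γ k (toSeq x ≫ toℕ j)
γ₂≡γ k x j = trans (lookup∘tabulate (λ i → lookup (S^ (k + k) x) i ∧ oddNegs k x i) j)
  (cong₂ _∧_ (lookup∘tabulate (λ i → lookup x (shiftIdx (k + k) i)) j) (oddNegs≡oddPrefix k x j))

sumFrom≡rule : ∀ {m t} k (as : Vec Bool t) (x : Vec Bool (suc m)) j →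
  sumFrom k as x j ≡ rule (X^ k · toList as) (toSeq x ≫ toℕ j)
sumFrom≡rule k Vec.[]         x j = sym (rule-zero _ (X^·-[] k))
sumFrom≡rule k (a Vec.∷ as) x j = begin
  (a ∧ lookup (γ₂ k x) j) xor sumFrom (suc k) as x j
    ≡⟨ cong₂ _xor_ (cong (a ∧_) (γ₂≡γ k x j)) (sumFrom≡rule (suc k) as x j) ⟩
  (a ∧ γ k (toSeq x ≫ toℕ j)) xor rule (X^ suc k · toList as) (toSeq x ≫ toℕ j)
    ≡⟨ sym (rule-X^·-∷ k a (toList as) _) ⟩
  rule (X^ k · (a ∷ toList as)) (toSeq x ≫ toℕ j) ∎
  where open ≡-Reasoning

fMap≡Φ : ∀ {t} (a : Vec Bool t) m (x : Vec Bool (suc m)) → fMap a m x ≡ Φ (Fpoly a) x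
fMap≡Φ a m x = tabulate-cong λ j →
  cong₂ _xor_ (sym (trans (cong (toSeq x) (+-identityʳ (toℕ j))) (toSeq-toℕ x j))) (sumFrom≡rule 1 a x j)

-- Invertibility of f when F is coprime to an annihilator

inverse⇒IsPerm : ∀ {t} (a : Vec Bool t) m (g : Vec Bool (suc m) → Vec Bool (suc m)) →
  (∀ x → g (fMap a m x) ≡ x) → (∀ y → fMap a m (g y) ≡ y) → IsPerm a m
inverse⇒IsPerm a m g g∘f f∘g =
  (λ {x} {y} fx≡fy → trans (sym (g∘f x)) (trans (cong g fx≡fy) (g∘f y))) ,
  λ y → g y , λ { refl → f∘g y }

coprime⇒IsPerm : ∀ {t} (a : Vec Bool t) m {M} u v → Annihilates M (suc m) → coeff M 0 ≡ false →
  oneₚ ≐ (u *ₚ Fpoly a) +ₚ (v *ₚ M) → IsPerm a m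
coprime⇒IsPerm a m {M} u v ann M0 bez = inverse⇒IsPerm a m (Φ u) u∘F F∘u
  where
  F = Fpoly a
  uF≐ : u *ₚ F ≐ oneₚ +ₚ (v *ₚ M)
  uF≐ = +ₚ-solve (≐-trans bez (+ₚ-comm (u *ₚ F) (v *ₚ M)))
  u0 : coeff u 0 ≡ true
  u0 = begin
    coeff u 0                          ≡⟨ sym (∧-identityʳ _) ⟩
    coeff u 0 ∧ coeff F 0              ≡⟨ sym (coeff0-*ₚ u F) ⟩
    coeff (u *ₚ F) 0                   ≡⟨ trans (coeff-≡ uF≐ 0) (coeff-+ oneₚ (v *ₚ M) 0) ⟩
    true xor coeff (v *ₚ M) 0          ≡⟨ cong (true xor_) (trans (coeff0-*ₚ v M) (trans (cong (coeff v 0 ∧_) M0) (∧-zeroʳ _))) ⟩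
    true                               ∎
    where open ≡-Reasoning
  u∘F : ∀ x → Φ u (fMap a m x) ≡ x
  u∘F x = trans (cong (Φ u) (fMap≡Φ a m x)) (trans (Φ-∘ u {F} refl x) (Φ-identity ann v uF≐ x))
  F∘u : ∀ y → fMap a m (Φ u y) ≡ y
  F∘u y = trans (fMap≡Φ a m (Φ u y)) (trans (Φ-∘ F {u} u0 y) (Φ-identity ann v (≐-trans (*ₚ-comm F u) uF≐) y))

IsPerm-or-common-factor : ∀ {t} (a : Vec Bool t) m {M} → Annihilates M (suc m) → coeff M 0 ≡ false →
  IsPerm a m ⊎ ∃ λ g → Irreducible g × g divides Fpoly a × g divides M
IsPerm-or-common-factor a m {M} ann M0 with bezout (Fpoly a) M
... | record { gcd = d ; gcd∣a = d∣F ; gcd∣b = d∣M ; u = u ; v = v ; identity = d≐ } with zero-or-Deg d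
...   | inj₁ d≐[]        = contradiction (trans (sym (divides-coeff0 d∣F refl)) (coeff-≡ d≐[] 0)) λ ()
...   | inj₂ (zero , Dd)  = inj₁ (coprime⇒IsPerm a m u v ann M0 (≐-trans (≐-sym (Deg0⇒≐oneₚ Dd)) d≐))
...   | inj₂ (suc e , Dd) with irreducible-factor Dd
...     | g , irr , g∣d = inj₂ (g , irr , divides-trans g∣d d∣F , divides-trans g∣d d∣M)

¬divides-one : ∀ {g k} → Deg g (suc k) → ¬ g divides oneₚ
¬divides-one {k = k} Dg g∣1 = contradiction (coeff-≡ (multiple-of-smaller-degree Dg g∣1 one-below) 0) λ ()
  where
  one-below : DegBelow oneₚ (suc k)
  one-below = degBelow λ { (suc i) _ → refl }

IsPerm-odd : ∀ {t} (a : Vec Bool t) r → IsPerm a (r + r)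
IsPerm-odd a r with IsPerm-or-common-factor a (r + r) (annihilates-odd r) refl
... | inj₁ perm = perm
... | inj₂ (g , irr , g∣F , g∣M) =
  contradiction (divides-X^·⁻¹ (suc r) (divides-coeff0 g∣F refl) g∣M) (¬divides-one (proj₂ (Irreducible⇒Nonconstant irr)))

ObstructingFactor : ∀ {t} → Vec Bool t → ℕ → Set
ObstructingFactor a m = ∃[ g ] ∃[ ℓ ] (Irreducible g × (g ∣ₚ Fpoly a) × IsOrd g ℓ × ((2 * ℓ) ∣ suc m))

2*n≡n+n : ∀ n → 2 * n ≡ n + n
2*n≡n+n n = cong (n +_) (+-identityʳ n)

IsPerm-or-obstructed-even : ∀ {t} (a : Vec Bool t) h m → suc m ≡ h + h → IsPerm a m ⊎ ObstructingFactor a m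
IsPerm-or-obstructed-even a zero    m ()
IsPerm-or-obstructed-even a (suc h) m n≡2h
  with IsPerm-or-common-factor a m (subst (Annihilates (X^ suc h · xPow+1 (suc h))) (sym n≡2h) (annihilates-even (suc h))) refl
... | inj₁ perm = inj₁ perm
... | inj₂ (g , irr , g∣F , g∣M) with Irreducible⇒Nonconstant irr
...   | k , Dg with order-exists Dg (s≤s z≤n) (divides-X^·⁻¹ (suc h) (divides-coeff0 g∣F refl) g∣M)
...     | ℓ , ord , ℓ∣h = inj₂ (g , ℓ , irr , divides⇒∣ₚ g∣F , ord , 2ℓ∣n)
  where
  2ℓ∣n : 2 * ℓ ∣ suc m
  2ℓ∣n = subst (2 * ℓ ∣_) (trans (2*n≡n+n (suc h)) (sym n≡2h)) (*-monoʳ-∣ 2 ℓ∣h)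

even-or-odd : ∀ n → (∃ λ h → n ≡ h + h) ⊎ (∃ λ r → n ≡ suc (r + r))
even-or-odd zero    = inj₁ (0 , refl)
even-or-odd (suc n) with even-or-odd n
... | inj₁ (h , n≡2h)   = inj₂ (h , cong suc n≡2h)
... | inj₂ (r , n≡2r+1) = inj₁ (suc r , cong suc (trans n≡2r+1 (sym (+-suc r r))))

IsPerm-or-obstructed : ∀ {t} (a : Vec Bool t) m → IsPerm a m ⊎ ObstructingFactor a m
IsPerm-or-obstructed a m with even-or-odd (suc m)
... | inj₁ (h , n≡2h)   = IsPerm-or-obstructed-even a h m n≡2h
... | inj₂ (r , n≡2r+1) = inj₁ (subst (IsPerm a) (sym (suc-injective n≡2r+1)) (IsPerm-odd a r))

-- Non-injectivity of f from an obstructing factor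

multipleOf : ℕ → Seq
multipleOf p i = does (p ∣? i)

multipleOf⇒∣ : ∀ p i → multipleOf p i ≡ true → p ∣ i
multipleOf⇒∣ p i eq with p ∣? i
... | yes p∣i = p∣i
... | no  _   = contradiction eq λ ()

multipleOf-periodic : ∀ p → Periodic p (multipleOf p)
multipleOf-periodic p i with p ∣? (p + i) | p ∣? i
... | yes p∣p+i | no ¬p∣i   = contradiction (∣m+n∣m⇒∣n p∣p+i ∣-refl) ¬p∣i
... | no ¬p∣p+i | yes p∣i   = contradiction (∣m∣n⇒∣m+n ∣-refl p∣i) ¬p∣p+i
... | yes _     | yes _     = refl
... | no _      | no _      = refl

¬2∣odd : ∀ j → ¬ 2 ∣ suc (j + j)
¬2∣odd j 2∣odd = contradiction (trans (sym ([m+kn]%n≡m%n 1 j 2)) (trans (cong (_% 2) odd≡) (n∣m⇒m%n≡0 _ 2 2∣odd))) λ ()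
  where
  odd≡ : 1 + j * 2 ≡ suc (j + j)
  odd≡ = cong suc (trans (*-comm j 2) (2*n≡n+n j))

rule-xPow+1-multipleOf : ∀ ℓ c → rule (xPow+1 ℓ) (multipleOf (2 * ℓ) ≫ c) ≡ false
rule-xPow+1-multipleOf ℓ c = begin
  rule ((X^ ℓ · oneₚ) +ₚ oneₚ) u              ≡⟨ rule-+ₚ (X^ ℓ · oneₚ) oneₚ u ⟩
  rule (X^ ℓ · oneₚ) u xor rule oneₚ u        ≡⟨ cong₂ _xor_ (rule-X^·-one ℓ u) (rule-one u) ⟩
  (u (ℓ + ℓ) ∧ oddPrefix ℓ u) xor u 0          ≡⟨ cong (λ x → (x ∧ oddPrefix ℓ u) xor u 0) u₂ℓ≡u₀ ⟩
  (u 0 ∧ oddPrefix ℓ u) xor u 0               ≡⟨ [x∧y]xorx (u 0) (oddPrefix ℓ u) odd-zero ⟩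
  false                                       ∎
  where
  open ≡-Reasoning
  u = multipleOf (2 * ℓ) ≫ c
  u₂ℓ≡u₀ : u (ℓ + ℓ) ≡ u 0
  u₂ℓ≡u₀ = trans (cong u (sym (trans (+-identityʳ _) (2*n≡n+n ℓ)))) (Periodic-≫ c (multipleOf-periodic (2 * ℓ)) 0)
  odd-zero : u 0 ≡ true → oddPrefix ℓ u ≡ true
  odd-zero u₀ = oddPrefix-intro ℓ u λ j _ → dec-false (2 * ℓ ∣? (c + suc (j + j))) λ 2ℓ∣ →
    ¬2∣odd j (∣-trans (m∣m*n ℓ) (∣m+n∣m⇒∣n 2ℓ∣ (subst (2 * ℓ ∣_) (+-identityʳ c) (multipleOf⇒∣ _ _ u₀))))
  [x∧y]xorx : ∀ x y → (x ≡ true → y ≡ true) → (x ∧ y) xor x ≡ false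
  [x∧y]xorx false y _   = refl
  [x∧y]xorx true  y x⇒y = cong (_xor true) (x⇒y refl)

rule-window : ∀ {C k} w → DegBelow C (suc k) → (∀ i → i < k → w (suc i + suc i) ≡ false) → rule C w ≡ coeff C 0 ∧ w 0
rule-window {[]}    w bC zeros = refl
rule-window {c ∷ C} w bC zeros = begin
  (c ∧ w 0) xor (not (w 1) ∧ rule C (w ≫ 2))   ≡⟨ cong (λ r → (c ∧ w 0) xor (not (w 1) ∧ r)) rest ⟩
  (c ∧ w 0) xor (not (w 1) ∧ false)           ≡⟨ trans (cong ((c ∧ w 0) xor_) (∧-zeroʳ _)) (xor-identityʳ _) ⟩
  c ∧ w 0                                     ∎
  where
  open ≡-Reasoning
  rest : rule C (w ≫ 2) ≡ false
  rest = rule-vanishes (w ≫ 2) (DegBelow-tail bC) λ i i<k → trans (cong (w ∘ suc) (sym (+-suc i i))) (zeros i i<k)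

Deg-X^·-one : ∀ k → Deg (X^ k · oneₚ) k
Deg-X^·-one zero    = degree refl (degBelow λ { (suc i) _ → refl })
Deg-X^·-one (suc k) = Deg-∷ false (Deg-X^·-one k)

Deg-xPow+1 : ∀ ℓ → Deg (xPow+1 (suc ℓ)) (suc ℓ)
Deg-xPow+1 ℓ = Deg-∷ true (Deg-resp (≐-sym (+ₚ-identityʳ _)) (Deg-X^·-one ℓ))

cofactor-coeff0 : ∀ {g Q ℓ} → Q *ₚ g ≐ xPow+1 (suc ℓ) → coeff Q 0 ≡ true
cofactor-coeff0 {g} {Q} Qg≐T = ∧-conicalˡ _ _ (trans (sym (coeff0-*ₚ Q g)) (coeff-≡ Qg≐T 0))

Γ-cofactor-multipleOf : ∀ {F g Q Q′ ℓ} → Q′ *ₚ g ≐ F → Q *ₚ g ≐ xPow+1 (suc ℓ) →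
  ∀ k → Γ F (Γ Q (multipleOf (2 * suc ℓ))) k ≡ false
Γ-cofactor-multipleOf {F} {g} {Q} {Q′} {ℓ} Q′g≐F Qg≐T k = begin
  Γ F (Γ Q δ) k                    ≡⟨ Γ-∘ F (cofactor-coeff0 {g} {Q} Qg≐T) δ k ⟩
  Γ (F *ₚ Q) δ k                   ≡⟨ Γ-cong FQ≐Q′T δ k ⟩
  Γ (Q′ *ₚ T) δ k                  ≡⟨ sym (Γ-∘ Q′ refl δ k) ⟩
  Γ Q′ (Γ T δ) k                   ≡⟨ Γ-ext Q′ (rule-xPow+1-multipleOf (suc ℓ)) k ⟩
  rule Q′ (λ _ → false)            ≡⟨ rule-false Q′ ⟩
  false                            ∎
  where
  open ≡-Reasoning
  T = xPow+1 (suc ℓ)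
  δ = multipleOf (2 * suc ℓ)
  FQ≐Q′T : F *ₚ Q ≐ Q′ *ₚ T
  FQ≐Q′T = ≐-trans (*ₚ-congˡ Q (≐-sym Q′g≐F))
             (≐-trans (*ₚ-assoc Q′ g Q) (*ₚ-congʳ Q′ (≐-trans (*ₚ-comm g Q) Qg≐T)))

-- deg Q < ℓ, so below 2ℓ the sequence δ only meets the constant term of Q.
rule-cofactor-multipleOf : ∀ {g Q ℓ s} → Deg g (suc s) → Q *ₚ g ≐ xPow+1 (suc ℓ) →
  rule Q (multipleOf (2 * suc ℓ)) ≡ true
rule-cofactor-multipleOf {g} {Q} {ℓ} Dg Qg≐T with zero-or-Deg Q
... | inj₁ Q≐[]     = contradiction (trans (sym (cofactor-coeff0 {g} {Q} Qg≐T)) (coeff-≡ Q≐[] 0)) λ ()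
... | inj₂ (q , DQ) = trans (rule-window δ (below DQ) δ-zeros)
                            (cong₂ _∧_ (cofactor-coeff0 {g} {Q} Qg≐T) (dec-true (2 * suc ℓ ∣? 0) (ℕ.divides 0 refl)))
  where
  δ = multipleOf (2 * suc ℓ)
  q<ℓ : q < suc ℓ
  q<ℓ = subst (q <_) (Deg-unique (Deg-resp Qg≐T (Deg-*ₚ DQ Dg)) (Deg-xPow+1 ℓ)) (m<m+n q (s≤s z≤n))
  δ-zeros : ∀ i → i < q → δ (suc i + suc i) ≡ false
  δ-zeros i i<q = dec-false (2 * suc ℓ ∣? (suc i + suc i)) λ 2ℓ∣ →
    <⇒≱ (subst (suc i + suc i <_) (sym (2*n≡n+n (suc ℓ))) (+-mono-< i+1<ℓ i+1<ℓ)) (∣⇒≤ 2ℓ∣)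
    where i+1<ℓ = ≤-trans (s≤s i<q) q<ℓ

kernel-witness : ∀ {F g ℓ s} → Deg g (suc s) → g divides F → 1 ≤ ℓ → g divides xPow+1 ℓ →
  ∃ λ w → Periodic (2 * ℓ) w × (∀ k → Γ F w k ≡ false) × w 0 ≡ true
kernel-witness {F} {g} {suc ℓ} Dg (Q′ , Q′g≐F) _ (Q , Qg≐T) =
  Γ Q (multipleOf (2 * suc ℓ)) ,
  Γ-periodic Q {2 * suc ℓ} (multipleOf-periodic (2 * suc ℓ)) ,
  Γ-cofactor-multipleOf {F} {g} {Q} {Q′} Q′g≐F Qg≐T ,
  rule-cofactor-multipleOf {g} {Q} Dg Qg≐T

collision⇒¬IsPerm : ∀ {t} (a : Vec Bool t) m {w w′} → Periodic (suc m) w → Periodic (suc m) w′ →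
  Γ (Fpoly a) w ≗ Γ (Fpoly a) w′ → w 0 ≢ w′ 0 → ¬ IsPerm a m
collision⇒¬IsPerm a m {w} {w′} per per′ same w₀≢w′₀ (injective , _) = w₀≢w′₀ (begin
  w 0                               ≡⟨ sym (lookup∘tabulate (w ∘ toℕ {suc m}) Fin.zero) ⟩
  lookup (fromSeq {m} w) Fin.zero   ≡⟨ cong (λ x → lookup x Fin.zero) (injective {fromSeq w} {fromSeq w′} same-image) ⟩
  lookup (fromSeq {m} w′) Fin.zero  ≡⟨ lookup∘tabulate (w′ ∘ toℕ {suc m}) Fin.zero ⟩
  w′ 0                              ∎)
  where
  open ≡-Reasoning
  same-image : fMap a m (fromSeq w) ≡ fMap a m (fromSeq w′)
  same-image = begin
    fMap a m (fromSeq w)           ≡⟨ trans (fMap≡Φ a m (fromSeq w)) (Φ-fromSeq (Fpoly a) per) ⟩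
    fromSeq (Γ (Fpoly a) w)        ≡⟨ fromSeq-ext same ⟩
    fromSeq (Γ (Fpoly a) w′)       ≡⟨ sym (trans (fMap≡Φ a m (fromSeq w′)) (Φ-fromSeq (Fpoly a) per′)) ⟩
    fMap a m (fromSeq w′)          ∎

obstructed⇒¬IsPerm : ∀ {t} (a : Vec Bool t) m → ObstructingFactor a m → ¬ IsPerm a m
obstructed⇒¬IsPerm a m (g , ℓ , irr , g∣F , (1≤ℓ , g∣T , _) , 2ℓ∣n)
  with kernel-witness {Fpoly a} (proj₂ (Irreducible⇒Nonconstant irr)) (∣ₚ⇒divides g∣F) 1≤ℓ (∣ₚ⇒divides g∣T)
... | w , per , in-kernel , w₀ = collision⇒¬IsPerm a m {w} {λ _ → false} (Periodic-∣ 2ℓ∣n per) (λ _ → refl)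
  (λ k → trans (in-kernel k) (sym (rule-false (Fpoly a)))) (λ w₀≡false → contradiction (trans (sym w₀) w₀≡false) λ ())

theorem12 : ∀ (t : ℕ) (a : Vec Bool t)
    → (∀ (m : ℕ) → (¬ IsPerm a m)
         ⇔ (∃[ g ] ∃[ ℓ ] (Irreducible g × (g ∣ₚ Fpoly a) × IsOrd g ℓ × ((2 * ℓ) ∣ suc m))))
      × (∀ (N : ℕ) → ∃[ m ] ((N ≤ m) × IsPerm a m))
theorem12 t a = characterisation , unbounded
  where
  characterisation : ∀ m → (¬ IsPerm a m) ⇔ ObstructingFactor a m
  characterisation m = mk⇔
    (λ ¬perm → [ flip contradiction ¬perm , id ]′ (IsPerm-or-obstructed a m))
    (obstructed⇒¬IsPerm a m)
  unbounded : ∀ N → ∃[ m ] ((N ≤ m) × IsPerm a m)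
  unbounded N = N + N , m≤m+n N N , IsPerm-odd a N
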